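{- Let $(T,L)$ be a decorated plane tree of profile $(\mu,k-2)$, where $\sum_i\mu_i(i-2)=k-4$, $\mu_1\le1$ and $(\mu,k)\neq([1,2^{\mu_2},3],4)$. Then there exists a sequence of at most one decoration exchange and two glue and cut operations leading from $(T,L)$ to a nice decorated plane tree of profile $(\mu,k-2)$.
   Context: A decorated plane tree is $(T,L)$ with $T$ a tree embedded in the sphere and $L$ a subset of its leaves ($L$-leaves; other leaves are $\overline L$-leaves). It has profile $(\mu,\ell)$ if $|L|=\ell$ and $\mu_i$ is the number of vertices of $T$ not in $L$ of degree $i$. It is nice if $\mu_1=0$, or $\mu_1=1$ and the unique $\overline L$-leaf is adjacent to a vertex of maximal degree of $T$. Glue and cut: remove two $L$-leaves and replace them by an edge between their parents (drawn in the complement of $T$, at the positions of the removed leaf edges), creating a unique cycle; then remove an edge $uv$ of this cycle and attach two new $L$-leaves, one at $u$ and one at $v$, at the positions previously occupied by $uv$. Decoration exchange: if $u$ is an $\overline L$-leaf and $v,w$ are $L$-leaves adjacent to a common vertex and consecutive in the cyclic order around it, replace $L$ by $(L\setminus\{v\})\cup\{u\}$. -}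

module Defs where

open import Data.Nat using (ℕ; zero; suc; _+_; _*_; _≤_; _≡ᵇ_)
open import Data.Nat.DivMod using (_%_; m%n<n)
open import Data.Integer as ℤ using (ℤ)
open import Data.Fin as Fin using (Fin; toℕ; fromℕ<)
open import Data.Fin.Properties using () renaming (_≟_ to _≟F_)
open import Data.Bool using (Bool; true; false; not; _∧_; if_then_else_)
open import Data.List using (List; length; filterᵇ; allFin; map; upTo; foldr)
open import Data.Nat.ListAction using (sum)
open import Data.Product using (Σ; _×_; _,_; proj₁; proj₂; ∃)
open import Data.Product.Properties using (≡-dec)
open import Data.Sum using (_⊎_)
open import Relation.Nullary using (¬_; does)
open import Relation.Binary.PropositionalEquality using (_≡_; _≢_)
open import Relation.Binary.Construct.Closure.ReflexiveTransitive using (Star)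

-- Plane trees as rotation systems.
-- Vertices are Fin n; vertex v has degree deg v, and its incident
-- half-edges ("darts") are (v , i) for i : Fin (deg v), listed in the
-- cyclic (counterclockwise) order around v given by i ↦ i+1 mod deg v.
-- The edges are given by a fixed-point-free involution α on darts.
-- A rotation system of a tree is exactly a tree embedded in the sphere
-- (up to orientation-preserving homeomorphism).

Dart : (n : ℕ) → (Fin n → ℕ) → Set
Dart n deg = Σ (Fin n) (λ v → Fin (deg v))

_≟D_ : ∀ {n deg} → (x y : Dart n deg) → Relation.Nullary.Dec (x ≡ y)
_≟D_ = ≡-dec _≟F_ _≟F_

cyc : ∀ {k} → Fin k → Fin k
cyc {suc k} i = fromℕ< (m%n<n (suc (toℕ i)) (suc k))

σ : ∀ {n deg} → Dart n deg → Dart n deg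
σ (v , i) = v , cyc i

Adj : ∀ {n deg} → (Dart n deg → Dart n deg) → Fin n → Fin n → Set
Adj {deg = deg} α u w = Σ (Fin (deg u)) (λ i → proj₁ (α (u , i)) ≡ w)

sumDeg : ∀ {n} → (Fin n → ℕ) → ℕ
sumDeg {n} deg = sum (map deg (allFin n))

record PlaneTree (n : ℕ) (deg : Fin n → ℕ) : Set where
  field
    α        : Dart n deg → Dart n deg
    α-invol  : ∀ d → α (α d) ≡ d
    α-nofix  : ∀ d → α d ≢ d
    -- tree: connected with exactly n - 1 edges (n ≥ 1)
    connected : ∀ u w → Star (Adj α) u w
    edges     : sumDeg deg + 2 ≡ 2 * n

record DecTree (n : ℕ) (deg : Fin n → ℕ) : Set where
  field
    tree  : PlaneTree n deg
    L     : Fin n → Bool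
    L-leaf : ∀ v → L v ≡ true → deg v ≡ 1
  open PlaneTree tree public

open DecTree public

ell : ∀ {n deg} → DecTree n deg → ℕ
ell {n} T = length (filterᵇ (L T) (allFin n))

mu : ∀ {n deg} → DecTree n deg → ℕ → ℕ
mu {n} {deg} T i = length (filterᵇ (λ v → not (L T v) ∧ (deg v ≡ᵇ i)) (allFin n))

-- Σ_i μ_i (i - 2), as an integer.  μ_i = 0 for i > sumDeg deg, so the
-- sum over i ≤ sumDeg deg is the full (finitely supported) sum.
weightSum : ∀ {n deg} → DecTree n deg → ℤ
weightSum {deg = deg} T =
  foldr ℤ._+_ (ℤ.+ 0) (map (λ i → ℤ.+ (mu T i) ℤ.* (ℤ.+ i ℤ.- ℤ.+ 2)) (upTo (suc (sumDeg deg))))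

Nice : ∀ {n deg} → DecTree n deg → Set
Nice {n} {deg} T =
  mu T 1 ≡ 0 ⊎
  (mu T 1 ≡ 1 ×
   Σ (Dart n deg) (λ x → deg (proj₁ x) ≡ 1 × L T (proj₁ x) ≡ false ×
     (∀ w → deg w ≤ deg (proj₁ (α T x)))))

update : ∀ {n deg} → Dart n deg → Dart n deg → (Dart n deg → Dart n deg) → Dart n deg → Dart n deg
update x y f d = if does (d ≟D x) then y else f d

pairUp : ∀ {n deg} → (Dart n deg → Dart n deg) → Dart n deg → Dart n deg → Dart n deg → Dart n deg
pairUp f x y = update x y (update y x f)

-- Glue and cut.  la , lb are the darts of the two L-leaves removed;
-- glue: connect their parents' darts α la and α lb by a new edge (at the
-- positions of the removed leaf edges); cut: remove the edge {e , α₁ e}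
-- of the resulting cycle and attach the two L-leaves at its endpoints,
-- at the positions previously occupied by that edge.  The requirement
-- that {e , α₁ e} lies on the cycle is exactly that the result is again
-- a tree, which is enforced by T' being a DecTree.
glued : ∀ {n deg} → (Dart n deg → Dart n deg) → Dart n deg → Dart n deg → Dart n deg → Dart n deg
glued α la lb = pairUp α (α la) (α lb)

glueCut : ∀ {n deg} → (Dart n deg → Dart n deg) → (la lb e : Dart n deg) → Dart n deg → Dart n deg
glueCut α la lb e = pairUp (pairUp α₁ e la) (α₁ e) lb
  where α₁ = glued α la lb

GlueCut : ∀ {n deg} → DecTree n deg → DecTree n deg → Set
GlueCut {n} {deg} T T' =
  Σ (Dart n deg) λ la → Σ (Dart n deg) λ lb → Σ (Dart n deg) λ e →
    L T (proj₁ la) ≡ true × L T (proj₁ lb) ≡ true ×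
    proj₁ la ≢ proj₁ lb × α T la ≢ lb ×
    e ≢ la × e ≢ lb ×
    (∀ d → α T' d ≡ glueCut (α T) la lb e d) ×
    (∀ v → L T' v ≡ L T v)

-- Decoration exchange: u an L̄-leaf, v , w distinct L-leaves adjacent to a
-- common vertex and consecutive in the cyclic order around it;
-- L' = (L ∖ {v}) ∪ {u}.
DecExchange : ∀ {n deg} → DecTree n deg → DecTree n deg → Set
DecExchange {n} {deg} T T' =
  Σ (Fin n) λ u → Σ (Dart n deg) λ x → Σ (Dart n deg) λ y →
    deg u ≡ 1 × L T u ≡ false ×
    L T (proj₁ x) ≡ true × L T (proj₁ y) ≡ true × proj₁ x ≢ proj₁ y ×
    (σ (α T x) ≡ α T y ⊎ σ (α T y) ≡ α T x) ×
    (∀ d → α T' d ≡ α T d) ×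
    L T' u ≡ true × L T' (proj₁ x) ≡ false ×
    (∀ z → z ≢ u → z ≢ proj₁ x → L T' z ≡ L T z)

data Steps {n deg} : ℕ → ℕ → DecTree n deg → DecTree n deg → Set where
  done : ∀ {T} → Steps 0 0 T T
  de   : ∀ {d g T T₁ T₂} → DecExchange T T₁ → Steps d g T₁ T₂ → Steps (suc d) g T T₂
  gc   : ∀ {d g T T₁ T₂} → GlueCut T T₁ → Steps d g T₁ T₂ → Steps d (suc g) T T₂

-- If μ₁ = 0 the tree is nice already, so let u be the unique L̄-leaf and root the tree at u.
-- If the neighbour of u has maximal degree D the tree is nice; otherwise let m be a deepest vertex
-- of degree D.  Then m lies strictly below the neighbour of u, so D ≥ 3, and the two positions
-- following the parent edge of m in the rotation hold children q₁, q₂.  Choose a leaf a outside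
-- the subtrees of q₁ and q₂: below a third child of m if D ≥ 4; if D = 3, the weight condition
-- (with the exceptional profile excluded) gives a second vertex of degree 3, which is not below
-- the deepest m, and a is taken below one of its children that is not an ancestor of m.
-- Each qᵢ that is not a leaf is cut from m by a glue and cut that hangs an L-leaf in its place:
-- a replaces the first, which in exchange receives a leaf b from its own subtree, and b then
-- replaces the second.  The two positions after the parent edge of m now hold consecutive
-- L-leaves, and exchanging the decoration of u with the first of them gives a nice tree, since
-- its neighbour m has degree D.

module Submission where

open import Defs
open import Data.Bool using (Bool; true; false; not; _∧_; if_then_else_)
open import Data.Bool.Properties using (∧-zeroʳ) renaming (_≟_ to _≟B_)
open import Data.Empty using (⊥-elim)
open import Data.Fin using (Fin; zero; suc; toℕ; punchIn; splitAt; join)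
open import Data.Fin.Properties
  using (any?; punchIn-injective; punchInᵢ≢i; join-splitAt; injective⇒≤; toℕ-fromℕ<; toℕ<n)
  renaming (_≟_ to _≟F_)
open import Data.Integer as ℤ using (ℤ; +_; -[1+_]; _⊖_; _-_)
import Data.Integer.Properties as ℤₚ
open import Data.List using (List; []; _∷_; map; _++_; foldr; length; allFin; filterᵇ; applyUpTo; upTo; lookup)
open import Data.List.Extrema.Nat using (argmax; f[xs]≤f[argmax])
open import Data.List.Membership.Propositional using (_∈_)
open import Data.List.Membership.Propositional.Properties using (∈-allFin; ∈-++⁺ˡ; ∈-++⁺ʳ; ∈-map⁺)
open import Data.List.Properties using (length-++; length-map; length-tabulate)
open import Data.List.Relation.Unary.All as All using ()
open import Data.List.Relation.Unary.Any using (here; there; index)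
open import Data.List.Relation.Unary.Any.Properties using (lookup-index)
open import Data.List.Relation.Unary.Unique.Propositional using (Unique; []; _∷_)
open import Data.List.Relation.Unary.Unique.Propositional.Properties using (allFin⁺)
open import Data.Nat using (ℕ; zero; suc; _+_; _≤_; _<_; _≡ᵇ_; _⊔_; z≤n; s≤s; s≤s⁻¹)
open import Data.Nat.DivMod using (_%_; m%n<n; m<n⇒m%n≡m; n%n≡0)
open import Data.Nat.ListAction using (sum)
open import Data.Nat.Properties
open import Algebra.Properties.CommutativeSemigroup +-commutativeSemigroup using (interchange)
open import Data.Product using (Σ; ∃; _×_; _,_; proj₁; proj₂)
open import Data.Sum using (_⊎_; inj₁; inj₂; [_,_]′)
open import Function using (_∘_)
open import Relation.Binary.Construct.Closure.ReflexiveTransitive using (Star; ε; _◅_; _◅◅_)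
open import Relation.Binary.PropositionalEquality
open import Relation.Nullary using (¬_; Dec; yes; no; does)
open import Relation.Nullary.Decidable using (_×-dec_; _⊎-dec_; ¬?; dec-true; dec-false)

false≢true : false ≢ true
false≢true ()

Fin1-unique : ∀ {k} → k ≡ 1 → (i j : Fin k) → i ≡ j
Fin1-unique refl zero zero = refl

≢⇒2≤ : ∀ {k} {i j : Fin k} → i ≢ j → 2 ≤ k
≢⇒2≤ {suc zero} {zero} {zero} i≢j = ⊥-elim (i≢j refl)
≢⇒2≤ {suc (suc k)} _ = s≤s (s≤s z≤n)

∃-≢ : ∀ {k} → 2 ≤ k → (i : Fin k) → ∃ λ j → j ≢ i
∃-≢ (s≤s (s≤s _)) zero = suc zero , λ ()
∃-≢ (s≤s (s≤s _)) (suc i) = zero , λ ()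

1≤≢1⇒2≤ : ∀ {k} → 1 ≤ k → k ≢ 1 → 2 ≤ k
1≤≢1⇒2≤ {suc zero} _ k≢1 = ⊥-elim (k≢1 refl)
1≤≢1⇒2≤ {suc (suc k)} _ _ = s≤s (s≤s z≤n)

argmax-Fin : ∀ {n} (f : Fin (suc n) → ℕ) → ∃ λ x → ∀ y → f y ≤ f x
argmax-Fin f = argmax f zero (allFin _) , λ y → All.lookup (f[xs]≤f[argmax] {f = f} zero (allFin _)) (∈-allFin y)

least-witness : (P : ℕ → Set) → (∀ k → Dec (P k)) → ∀ K → P K →
                ∃ λ k → P k × (∀ j → j < k → ¬ P j)
least-witness P P? zero p = zero , p , λ _ ()
least-witness P P? (suc K) p with P? zero
... | yes p0 = zero , p0 , λ _ ()
... | no ¬p0 with least-witness (λ k → P (suc k)) (λ k → P? (suc k)) K p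
...   | k , pk , below = suc k , pk , smaller
  where
  smaller : ∀ j → j < suc k → ¬ P j
  smaller zero _ = ¬p0
  smaller (suc j) (s≤s j<k) = below j j<k

module _ {K : ℕ} (x y z : Fin K) where
  private
    OneOf : Fin K → Set
    OneOf w = w ≡ x ⊎ w ≡ y ⊎ w ≡ z

    slot : ∀ w → OneOf w → Fin 3
    slot _ (inj₁ _) = zero
    slot _ (inj₂ (inj₁ _)) = suc zero
    slot _ (inj₂ (inj₂ _)) = suc (suc zero)

    slot-injective : ∀ v w (p : OneOf v) (q : OneOf w) → slot v p ≡ slot w q → v ≡ w
    slot-injective v w (inj₁ refl) (inj₁ refl) _ = refl
    slot-injective v w (inj₂ (inj₁ refl)) (inj₂ (inj₁ refl)) _ = refl
    slot-injective v w (inj₂ (inj₂ refl)) (inj₂ (inj₂ refl)) _ = refl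
    slot-injective v w (inj₁ _) (inj₂ (inj₁ _)) ()
    slot-injective v w (inj₁ _) (inj₂ (inj₂ _)) ()
    slot-injective v w (inj₂ (inj₁ _)) (inj₁ _) ()
    slot-injective v w (inj₂ (inj₁ _)) (inj₂ (inj₂ _)) ()
    slot-injective v w (inj₂ (inj₂ _)) (inj₁ _) ()
    slot-injective v w (inj₂ (inj₂ _)) (inj₂ (inj₁ _)) ()

    Avoids : Fin K → Set
    Avoids w = w ≢ x × w ≢ y × w ≢ z

    one-of : (∀ w → ¬ Avoids w) → ∀ w → OneOf w
    one-of none w with w ≟F x | w ≟F y | w ≟F z
    ... | yes w≡x | _ | _ = inj₁ w≡x
    ... | no _ | yes w≡y | _ = inj₂ (inj₁ w≡y)
    ... | no _ | no _ | yes w≡z = inj₂ (inj₂ w≡z)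
    ... | no w≢x | no w≢y | no w≢z = ⊥-elim (none w (w≢x , w≢y , w≢z))

  ∃-avoiding-three : 4 ≤ K → ∃ Avoids
  ∃-avoiding-three 4≤K with any? (λ w → ¬? (w ≟F x) ×-dec ¬? (w ≟F y) ×-dec ¬? (w ≟F z))
  ... | yes found = found
  ... | no none = ⊥-elim (<-irrefl refl (≤-trans 4≤K (injective⇒≤ {f = f} f-injective)))
    where
    f : Fin K → Fin 3
    f w = slot w (one-of (λ w avoids → none (w , avoids)) w)
    f-injective : ∀ {v w} → f v ≡ f w → v ≡ w
    f-injective {v} {w} = slot-injective v w _ _

data CycView {k : ℕ} (i : Fin (suc k)) : Set where
  step : toℕ i < k → toℕ (cyc i) ≡ suc (toℕ i) → CycView i
  wrap : toℕ i ≡ k → toℕ (cyc i) ≡ 0 → CycView i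

toℕ-cyc : ∀ {k} (i : Fin (suc k)) → toℕ (cyc i) ≡ suc (toℕ i) % suc k
toℕ-cyc {k} i = toℕ-fromℕ< (m%n<n (suc (toℕ i)) (suc k))

cyc-view : ∀ {k} (i : Fin (suc k)) → CycView i
cyc-view {k} i with m≤n⇒m<n∨m≡n (s≤s⁻¹ (toℕ<n i))
... | inj₁ i<k = step i<k (trans (toℕ-cyc i) (m<n⇒m%n≡m (s≤s i<k)))
... | inj₂ i≡k = wrap i≡k (trans (toℕ-cyc i) (subst (λ t → suc t % suc k ≡ 0) (sym i≡k) (n%n≡0 (suc k))))

cyc-≢ : ∀ {K} (i : Fin K) → 2 ≤ K → cyc i ≢ i
cyc-≢ {suc k} i (s≤s 1≤k) cyc[i]≡i with cyc-view i
... | step _ eq = 1+n≢n (trans (sym eq) (cong toℕ cyc[i]≡i))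
... | wrap i≡k eq = <⇒≢ 1≤k (trans (sym eq) (trans (cong toℕ cyc[i]≡i) i≡k))

cyc²-≢ : ∀ {K} (i : Fin K) → 3 ≤ K → cyc (cyc i) ≢ i
cyc²-≢ {suc k} i (s≤s 2≤k) cyc²[i]≡i with cyc-view i | cyc-view (cyc i)
... | step _ eq | step _ eq′ =
  m+1+n≢n 1 (trans (sym (trans eq′ (cong suc eq))) (cong toℕ cyc²[i]≡i))
... | step _ eq | wrap i′≡k eq′ =
  <⇒≢ 2≤k (trans (cong suc (trans (sym eq′) (cong toℕ cyc²[i]≡i))) (trans (sym eq) i′≡k))
... | wrap i≡k eq | step _ eq′ =
  <⇒≢ 2≤k (sym (trans (sym i≡k) (trans (sym (cong toℕ cyc²[i]≡i)) (trans eq′ (cong suc eq)))))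
... | wrap _ eq | wrap i′≡k _ = <⇒≢ (≤-trans (s≤s z≤n) 2≤k) (trans (sym eq) i′≡k)

∈⇒≤sum : ∀ {k ks} → k ∈ ks → k ≤ sum ks
∈⇒≤sum {ks = k ∷ ks} (here refl) = m≤m+n k (sum ks)
∈⇒≤sum {ks = k′ ∷ ks} (there k∈ks) = ≤-trans (∈⇒≤sum k∈ks) (m≤n+m (sum ks) k′)

count : {A : Set} → (A → Bool) → List A → ℕ
count P xs = length (filterᵇ P xs)

𝟙 : Bool → ℕ
𝟙 b = if b then 1 else 0

module _ {A : Set} (P : A → Bool) where

  count-accept : ∀ {x} xs → P x ≡ true → count P (x ∷ xs) ≡ suc (count P xs)
  count-accept xs Px rewrite Px = refl

  count-reject : ∀ {x} xs → P x ≡ false → count P (x ∷ xs) ≡ count P xs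
  count-reject xs Px rewrite Px = refl

  count-∷ : ∀ x xs → count P (x ∷ xs) ≡ 𝟙 (P x) + count P xs
  count-∷ x xs with P x
  ... | true = refl
  ... | false = refl

  count-∷-≤ : ∀ x xs → count P xs ≤ count P (x ∷ xs)
  count-∷-≤ x xs with P x in Px
  ... | true = n≤1+n _
  ... | false = ≤-refl

  count-none : ∀ xs → (∀ {x} → x ∈ xs → P x ≡ false) → count P xs ≡ 0
  count-none [] _ = refl
  count-none (x ∷ xs) none =
    trans (count-reject xs (none (here refl))) (count-none xs (λ x∈xs → none (there x∈xs)))

  count≤1 : ∀ {m xs} → Unique xs → (∀ x → P x ≡ true → x ≡ m) → count P xs ≤ 1
  count≤1 [] _ = z≤n
  count≤1 {xs = x ∷ xs} (x∉xs ∷ unique) only with P x in Px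
  ... | true = s≤s (≤-reflexive (count-none xs rejected))
    where
    rejected : ∀ {y} → y ∈ xs → P y ≡ false
    rejected {y} y∈xs with P y in Py
    ... | true = ⊥-elim (All.lookup x∉xs y∈xs (trans (only x Px) (sym (only y Py))))
    ... | false = refl
  ... | false = count≤1 unique only

  1≤count : ∀ {x xs} → x ∈ xs → P x ≡ true → 1 ≤ count P xs
  1≤count {xs = y ∷ ys} (here refl) Px = subst (1 ≤_) (sym (count-accept ys Px)) (s≤s z≤n)
  1≤count {xs = y ∷ ys} (there x∈ys) Px = ≤-trans (1≤count x∈ys Px) (count-∷-≤ y ys)

  2≤count : ∀ {x y xs} → x ∈ xs → y ∈ xs → x ≢ y → P x ≡ true → P y ≡ true → 2 ≤ count P xs
  2≤count (here refl) (here refl) x≢y _ _ = ⊥-elim (x≢y refl)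
  2≤count {xs = w ∷ ws} (here refl) (there y∈ws) _ Px Py =
    subst (2 ≤_) (sym (count-accept ws Px)) (s≤s (1≤count y∈ws Py))
  2≤count {xs = w ∷ ws} (there x∈ws) (here refl) _ Px Py =
    subst (2 ≤_) (sym (count-accept ws Py)) (s≤s (1≤count x∈ws Px))
  2≤count {xs = w ∷ ws} (there x∈ws) (there y∈ws) x≢y Px Py =
    ≤-trans (2≤count x∈ws y∈ws x≢y Px Py) (count-∷-≤ w ws)

  1≤count⇒∃ : ∀ xs → 1 ≤ count P xs → ∃ λ x → P x ≡ true
  1≤count⇒∃ (x ∷ xs) 1≤c with P x in Px
  ... | true = x , Px
  ... | false = 1≤count⇒∃ xs 1≤c

count-cong : {A : Set} {P Q : A → Bool} → ∀ xs → (∀ x → P x ≡ Q x) → count P xs ≡ count Q xs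
count-cong [] _ = refl
count-cong {P = P} {Q} (x ∷ xs) P≗Q with P x in Px
... | true = trans (cong suc (count-cong xs P≗Q)) (sym (count-accept Q xs (trans (sym (P≗Q x)) Px)))
... | false = trans (count-cong xs P≗Q) (sym (count-reject Q xs (trans (sym (P≗Q x)) Px)))

2≤count⇒∃-≢ : ∀ {n} (P : Fin n → Bool) m → 2 ≤ count P (allFin n) → ∃ λ v → v ≢ m × P v ≡ true
2≤count⇒∃-≢ {n} P m 2≤c with any? (λ v → ¬? (v ≟F m) ×-dec (P v ≟B true))
... | yes found = found
... | no none = ⊥-elim (<-irrefl refl (≤-trans 2≤c (count≤1 P (allFin⁺ n) only)))
  where
  only : ∀ v → P v ≡ true → v ≡ m
  only v Pv with v ≟F m
  ... | yes v≡m = v≡m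
  ... | no v≢m = ⊥-elim (none (v , v≢m , Pv))

module _ {n : ℕ} where
  private
    is : Fin n → Fin n → Bool
    is x y = does (y ≟F x)

    count-is : ∀ x → count (is x) (allFin n) ≡ 1
    count-is x = ≤-antisym (count≤1 (is x) (allFin⁺ n) is⇒≡) (1≤count (is x) (∈-allFin x) (dec-true (x ≟F x) refl))
      where
      is⇒≡ : ∀ y → is x y ≡ true → y ≡ x
      is⇒≡ y isxy with y ≟F x
      ... | yes y≡x = y≡x

  -- P + 𝟙[· ≡ a] and Q + 𝟙[· ≡ u] agree pointwise, and each indicator counts once.
  count-exchange : (P Q : Fin n → Bool) {u a : Fin n} → u ≢ a → (∀ y → y ≢ u → y ≢ a → P y ≡ Q y) →
                   P u ≡ true → Q u ≡ false → P a ≡ false → Q a ≡ true →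
                   count P (allFin n) ≡ count Q (allFin n)
  count-exchange P Q {u} {a} u≢a P≗Q Pu Qu Pa Qa =
    +-cancelʳ-≡ 1 _ _ (subst₂ (λ i j → count P (allFin n) + i ≡ count Q (allFin n) + j)
                              (count-is a) (count-is u) (balanced (allFin n)))
    where
    pointwise : ∀ y → 𝟙 (P y) + 𝟙 (is a y) ≡ 𝟙 (Q y) + 𝟙 (is u y)
    pointwise y with y ≟F u | y ≟F a
    ... | yes refl | yes refl = ⊥-elim (u≢a refl)
    ... | yes refl | no _ = trans (cong (λ b → 𝟙 b + 0) Pu) (cong (λ b → 𝟙 b + 1) (sym Qu))
    ... | no _ | yes refl = trans (cong (λ b → 𝟙 b + 1) Pa) (cong (λ b → 𝟙 b + 0) (sym Qa))
    ... | no y≢u | no y≢a = cong (λ b → 𝟙 b + 0) (P≗Q y y≢u y≢a)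

    balanced : ∀ xs → count P xs + count (is a) xs ≡ count Q xs + count (is u) xs
    balanced [] = refl
    balanced (y ∷ ys) = begin
      count P (y ∷ ys) + count (is a) (y ∷ ys)
        ≡⟨ cong₂ _+_ (count-∷ P y ys) (count-∷ (is a) y ys) ⟩
      (𝟙 (P y) + count P ys) + (𝟙 (is a y) + count (is a) ys)
        ≡⟨ interchange (𝟙 (P y)) (count P ys) (𝟙 (is a y)) (count (is a) ys) ⟩
      (𝟙 (P y) + 𝟙 (is a y)) + (count P ys + count (is a) ys)
        ≡⟨ cong₂ _+_ (pointwise y) (balanced ys) ⟩
      (𝟙 (Q y) + 𝟙 (is u y)) + (count Q ys + count (is u) ys)
        ≡⟨ interchange (𝟙 (Q y)) (𝟙 (is u y)) (count Q ys) (count (is u) ys) ⟩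
      (𝟙 (Q y) + count Q ys) + (𝟙 (is u y) + count (is u) ys)
        ≡⟨ sym (cong₂ _+_ (count-∷ Q y ys) (count-∷ (is u) y ys)) ⟩
      count Q (y ∷ ys) + count (is u) (y ∷ ys) ∎
      where open ≡-Reasoning

module _ {n : ℕ} {deg : Fin n → ℕ} where

  position-injective : ∀ {v} {i j : Fin (deg v)} → _≡_ {A = Dart n deg} (v , i) (v , j) → i ≡ j
  position-injective refl = refl

  distinct-darts⇒2≤deg : ∀ {v} (x y : Dart n deg) → proj₁ x ≡ v → proj₁ y ≡ v → x ≢ y → 2 ≤ deg v
  distinct-darts⇒2≤deg (v , i) (v , j) refl refl x≢y = ≢⇒2≤ {i = i} {j} (x≢y ∘ cong (v ,_))

  σ-≢ : ∀ (d : Dart n deg) → 2 ≤ deg (proj₁ d) → σ d ≢ d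
  σ-≢ (v , i) 2≤deg σd≡d = cyc-≢ i 2≤deg (position-injective σd≡d)

  σ²-≢ : ∀ (d : Dart n deg) → 3 ≤ deg (proj₁ d) → σ (σ d) ≢ d
  σ²-≢ (v , i) 3≤deg σ²d≡d = cyc²-≢ i 3≤deg (position-injective σ²d≡d)

  update-hit : ∀ {x y : Dart n deg} {f d} → d ≡ x → update x y f d ≡ y
  update-hit {x} {y} {f} {d} d≡x = cong (λ b → if b then y else f d) (dec-true (d ≟D x) d≡x)

  update-miss : ∀ {x y : Dart n deg} {f d} → d ≢ x → update x y f d ≡ f d
  update-miss {x} {y} {f} {d} d≢x = cong (λ b → if b then y else f d) (dec-false (d ≟D x) d≢x)

  pairUp-fst : ∀ (f : Dart n deg → Dart n deg) x y → pairUp f x y x ≡ y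
  pairUp-fst f x y = update-hit {f = update y x f} {d = x} refl

  pairUp-snd : ∀ (f : Dart n deg → Dart n deg) x y → y ≢ x → pairUp f x y y ≡ x
  pairUp-snd f x y y≢x = trans (update-miss {f = update y x f} y≢x) (update-hit {f = f} {d = y} refl)

  pairUp-other : ∀ (f : Dart n deg → Dart n deg) x y {d} → d ≢ x → d ≢ y → pairUp f x y d ≡ f d
  pairUp-other f x y d≢x d≢y = trans (update-miss {f = update y x f} d≢x) (update-miss {f = f} d≢y)

module _ {A : Set} {f : A → A} (f-invol : ∀ x → f (f x) ≡ x) where

  involution-injective : ∀ {x y} → f x ≡ f y → x ≡ y
  involution-injective {x} {y} fx≡fy = trans (sym (f-invol x)) (trans (cong f fx≡fy) (f-invol y))

  involution-transpose : ∀ {x y} → f x ≡ y → x ≡ f y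
  involution-transpose {x} fx≡y = trans (sym (f-invol x)) (cong f fx≡y)

module GlueCutInvolution {n : ℕ} {deg : Fin n → ℕ} (α : Dart n deg → Dart n deg)
  (α-invol : ∀ d → α (α d) ≡ d) (α-nofix : ∀ d → α d ≢ d) (la lb e : Dart n deg)
  (la≢lb : la ≢ lb) (αla≢lb : α la ≢ lb) (la≢e : la ≢ e) (la≢αe : la ≢ α e) (lb≢e : lb ≢ e) (lb≢αe : lb ≢ α e)
  where

  α-injective : ∀ {x y} → α x ≡ α y → x ≡ y
  α-injective = involution-injective α-invol

  α-transpose : ∀ {x y} → α x ≡ y → x ≡ α y
  α-transpose = involution-transpose α-invol

  A B E : Dart n deg
  A = α la
  B = α lb
  E = α e

  private
    e≢A : e ≢ A
    e≢A e≡A = la≢αe (α-transpose (sym e≡A))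

    e≢B : e ≢ B
    e≢B e≡B = lb≢αe (α-transpose (sym e≡B))

    A≢B : A ≢ B
    A≢B = la≢lb ∘ α-injective

    α₁ : Dart n deg → Dart n deg
    α₁ = glued α la lb

    α₁e≡E : α₁ e ≡ E
    α₁e≡E = pairUp-other α A B e≢A e≢B

    cut : Dart n deg → Dart n deg
    cut = pairUp α₁ e la

    ≢E⇒≢α₁e : ∀ {d} → d ≢ E → d ≢ α₁ e
    ≢E⇒≢α₁e d≢E d≡α₁e = d≢E (trans d≡α₁e α₁e≡E)

  opaque
    g : Dart n deg → Dart n deg
    g = glueCut α la lb e

    g-def : ∀ d → g d ≡ glueCut α la lb e d
    g-def d = refl

    g-la : g la ≡ e
    g-la = trans (pairUp-other cut (α₁ e) lb (≢E⇒≢α₁e la≢αe) la≢lb) (pairUp-snd α₁ e la la≢e)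

    g-e : g e ≡ la
    g-e = trans (pairUp-other cut (α₁ e) lb (≢E⇒≢α₁e (λ e≡E → α-nofix e (sym e≡E))) (≢-sym lb≢e))
                (pairUp-fst α₁ e la)

    g-lb : g lb ≡ E
    g-lb = trans (pairUp-snd cut (α₁ e) lb (λ lb≡α₁e → lb≢αe (trans lb≡α₁e α₁e≡E))) α₁e≡E

    g-E : g E ≡ lb
    g-E = trans (cong g (sym α₁e≡E)) (pairUp-fst cut (α₁ e) lb)

    g-A : g A ≡ B
    g-A = trans (pairUp-other cut (α₁ e) lb (≢E⇒≢α₁e (la≢e ∘ α-injective)) αla≢lb)
                (trans (pairUp-other α₁ e la (≢-sym e≢A) (α-nofix la)) (pairUp-fst α A B))

    g-B : g B ≡ A
    g-B = trans (pairUp-other cut (α₁ e) lb (≢E⇒≢α₁e (lb≢e ∘ α-injective)) (α-nofix lb))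
                (trans (pairUp-other α₁ e la (≢-sym e≢B) (λ B≡la → αla≢lb (sym (α-transpose B≡la))))
                       (pairUp-snd α A B (≢-sym A≢B)))

    g-other : ∀ {d} → d ≢ la → d ≢ lb → d ≢ A → d ≢ B → d ≢ e → d ≢ E → g d ≡ α d
    g-other d≢la d≢lb d≢A d≢B d≢e d≢E =
      trans (pairUp-other cut (α₁ e) lb (≢E⇒≢α₁e d≢E) d≢lb)
            (trans (pairUp-other α₁ e la d≢e d≢la) (pairUp-other α A B d≢A d≢B))

  private
    swapped : ∀ {x y} → g x ≡ y → g y ≡ x → g (g x) ≡ x
    swapped gx≡y gy≡x = trans (cong g gx≡y) gy≡x

    moved : ∀ {x y} → g x ≡ y → x ≢ y → g x ≢ x
    moved gx≡y x≢y gx≡x = x≢y (trans (sym gx≡x) gx≡y)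

  involutive : ∀ d → g (g d) ≡ d
  involutive d with d ≟D la | d ≟D e | d ≟D lb | d ≟D E | d ≟D A | d ≟D B
  ... | yes refl | _ | _ | _ | _ | _ = swapped g-la g-e
  ... | no _ | yes refl | _ | _ | _ | _ = swapped g-e g-la
  ... | no _ | no _ | yes refl | _ | _ | _ = swapped g-lb g-E
  ... | no _ | no _ | no _ | yes refl | _ | _ = swapped g-E g-lb
  ... | no _ | no _ | no _ | no _ | yes refl | _ = swapped g-A g-B
  ... | no _ | no _ | no _ | no _ | no _ | yes refl = swapped g-B g-A
  ... | no d≢la | no d≢e | no d≢lb | no d≢E | no d≢A | no d≢B =
    trans (cong g (g-other d≢la d≢lb d≢A d≢B d≢e d≢E))
          (trans (g-other (d≢A ∘ α-transpose) (d≢B ∘ α-transpose) (d≢la ∘ α-injective) (d≢lb ∘ α-injective)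
                          (d≢E ∘ α-transpose) (d≢e ∘ α-injective))
                 (α-invol d))

  fixpoint-free : ∀ d → g d ≢ d
  fixpoint-free d with d ≟D la | d ≟D e | d ≟D lb | d ≟D E | d ≟D A | d ≟D B
  ... | yes refl | _ | _ | _ | _ | _ = moved g-la la≢e
  ... | no _ | yes refl | _ | _ | _ | _ = moved g-e (≢-sym la≢e)
  ... | no _ | no _ | yes refl | _ | _ | _ = moved g-lb lb≢αe
  ... | no _ | no _ | no _ | yes refl | _ | _ = moved g-E (≢-sym lb≢αe)
  ... | no _ | no _ | no _ | no _ | yes refl | _ = moved g-A A≢B
  ... | no _ | no _ | no _ | no _ | no _ | yes refl = moved g-B (≢-sym A≢B)
  ... | no d≢la | no d≢e | no d≢lb | no d≢E | no d≢A | no d≢B =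
    λ gd≡d → α-nofix d (trans (sym (g-other d≢la d≢lb d≢A d≢B d≢e d≢E)) gd≡d)

module Rooted {n′ : ℕ} {deg : Fin (suc n′) → ℕ} (T : PlaneTree (suc n′) deg)
              (r : Fin (suc n′)) (z : Fin (deg r)) where

  n : ℕ
  n = suc n′

  open PlaneTree T public
    renaming (α to β; α-invol to β-invol; α-nofix to β-nofix; connected to path; edges to edge-count)

  β-injective : ∀ {x y} → β x ≡ β y → x ≡ y
  β-injective = involution-injective β-invol

  β-transpose : ∀ {x y} → β x ≡ y → x ≡ β y
  β-transpose = involution-transpose β-invol

  ReachesRootIn : ℕ → Fin n → Set
  ReachesRootIn zero v = v ≡ r
  ReachesRootIn (suc k) v = Σ (Fin (deg v)) λ i → ReachesRootIn k (proj₁ (β (v , i)))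

  reachesRootIn? : ∀ k v → Dec (ReachesRootIn k v)
  reachesRootIn? zero v = v ≟F r
  reachesRootIn? (suc k) v = any? (λ i → reachesRootIn? k (proj₁ (β (v , i))))

  private
    walk⇒reachesRoot : ∀ {v w} → Star (Adj β) v w → w ≡ r → ∃ λ k → ReachesRootIn k v
    walk⇒reachesRoot ε w≡r = zero , w≡r
    walk⇒reachesRoot ((i , βvi≡x) ◅ walk) w≡r with walk⇒reachesRoot walk w≡r
    ... | k , reaches = suc k , i , subst (ReachesRootIn k) (sym βvi≡x) reaches

    shortest : ∀ v → Σ ℕ λ k → ReachesRootIn k v × (∀ j → j < k → ¬ ReachesRootIn j v)
    shortest v = let (K , reaches) = walk⇒reachesRoot (path v r) refl in
                 least-witness (λ k → ReachesRootIn k v) (λ k → reachesRootIn? k v) K reaches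

  opaque
    depth : Fin n → ℕ
    depth v = proj₁ (shortest v)

    depth-reaches : ∀ v → ReachesRootIn (depth v) v
    depth-reaches v = proj₁ (proj₂ (shortest v))

    depth-minimal : ∀ {k v} → ReachesRootIn k v → depth v ≤ k
    depth-minimal {k} {v} reaches = ≮⇒≥ (λ k<h → proj₂ (proj₂ (shortest v)) k k<h reaches)

  private
    ParentChoice : Fin n → Set
    ParentChoice v = v ≡ r ⊎ Σ (Fin (deg v)) λ i → depth (proj₁ (β (v , i))) < depth v

    parent-choice : ∀ v → ParentChoice v
    parent-choice v = go (depth v) (depth-reaches v) refl
      where
      go : ∀ k → ReachesRootIn k v → depth v ≡ k → ParentChoice v
      go zero v≡r _ = inj₁ v≡r
      go (suc k) (i , reaches) h≡1+k = inj₂ (i , ≤-<-trans (depth-minimal reaches) (subst (k <_) (sym h≡1+k) (n<1+n k)))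

    chosen-dart : ∀ v → ParentChoice v → Dart n deg
    chosen-dart v (inj₁ _) = r , z
    chosen-dart v (inj₂ (i , _)) = v , i

    chosen-dart-at : ∀ v (c : ParentChoice v) → v ≢ r →
                     Σ (Fin (deg v)) λ i → chosen-dart v c ≡ (v , i) × depth (proj₁ (β (v , i))) < depth v
    chosen-dart-at v (inj₁ v≡r) v≢r = ⊥-elim (v≢r v≡r)
    chosen-dart-at v (inj₂ (i , lt)) v≢r = i , refl , lt

  -- The root has no parent edge; there parentDart is the arbitrary dart (r , z).
  opaque
    parentDart : Fin n → Dart n deg
    parentDart v = chosen-dart v (parent-choice v)

    parentDart-at : ∀ v → v ≢ r → Σ (Fin (deg v)) λ i → parentDart v ≡ (v , i)
    parentDart-at v v≢r = let (i , eq , _) = chosen-dart-at v (parent-choice v) v≢r in i , eq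

  parent : Fin n → Fin n
  parent v = proj₁ (β (parentDart v))

  opaque
    unfolding parentDart
    depth-parent< : ∀ {v} → v ≢ r → depth (parent v) < depth v
    depth-parent< {v} v≢r with chosen-dart-at v (parent-choice v) v≢r
    ... | i , eq , lt = subst (λ d → depth (proj₁ (β d)) < depth v) (sym eq) lt

  parentDart-source : ∀ {v} → v ≢ r → proj₁ (parentDart v) ≡ v
  parentDart-source {v} v≢r = cong proj₁ (proj₂ (parentDart-at v v≢r))

  parentDart-injective : ∀ {v w} → v ≢ r → w ≢ r → parentDart v ≡ parentDart w → v ≡ w
  parentDart-injective v≢r w≢r eq = trans (sym (parentDart-source v≢r)) (trans (cong proj₁ eq) (parentDart-source w≢r))

  parentDart-≢ : ∀ {v w} → v ≢ r → w ≢ r → v ≢ w → parentDart v ≢ parentDart w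
  parentDart-≢ v≢r w≢r v≢w = v≢w ∘ parentDart-injective v≢r w≢r

  opposite-parentDart-≢ : ∀ {v w} → v ≢ r → w ≢ r → v ≢ w → β (parentDart v) ≢ β (parentDart w)
  opposite-parentDart-≢ v≢r w≢r v≢w = parentDart-≢ v≢r w≢r v≢w ∘ β-injective

  -- Otherwise v and w would each be the parent of the other, against the strict decrease of depth.
  parentDart≢opposite : ∀ {v w} → v ≢ r → w ≢ r → parentDart v ≢ β (parentDart w)
  parentDart≢opposite {v} {w} v≢r w≢r eq =
    <-asym (subst (λ x → depth x < depth v) parent-v≡w (depth-parent< v≢r))
           (subst (λ x → depth x < depth w) (sym v≡parent-w) (depth-parent< w≢r))
    where
    v≡parent-w : v ≡ parent w
    v≡parent-w = trans (sym (parentDart-source v≢r)) (cong proj₁ eq)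
    parent-v≡w : parent v ≡ w
    parent-v≡w = trans (cong (λ d → proj₁ (β d)) eq) (trans (cong proj₁ (β-invol (parentDart w))) (parentDart-source w≢r))

  opposite≢parentDart : ∀ {v w} → v ≢ r → w ≢ r → β (parentDart v) ≢ parentDart w
  opposite≢parentDart v≢r w≢r = parentDart≢opposite w≢r v≢r ∘ sym

  OnParentEdge : Dart n deg → Set
  OnParentEdge d = Σ (Fin n) λ c → c ≢ r × (d ≡ parentDart c ⊎ d ≡ β (parentDart c))

  private
    dart : (v : Fin n) → Fin (deg v) → Dart n deg
    dart v i = v , i

    dartsAt : List (Fin n) → List (Dart n deg)
    dartsAt [] = []
    dartsAt (v ∷ vs) = map (dart v) (allFin (deg v)) ++ dartsAt vs

    length-dartsAt : ∀ vs → length (dartsAt vs) ≡ sum (map deg vs)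
    length-dartsAt [] = refl
    length-dartsAt (v ∷ vs) = trans (length-++ (map (dart v) (allFin (deg v))))
      (cong₂ _+_ (trans (length-map (dart v) (allFin (deg v))) (length-tabulate {n = deg v} (λ i → i)))
                 (length-dartsAt vs))

    ∈-dartsAt : ∀ {v} vs → v ∈ vs → (i : Fin (deg v)) → (v , i) ∈ dartsAt vs
    ∈-dartsAt (w ∷ vs) (here refl) i = ∈-++⁺ˡ (∈-map⁺ (dart w) (∈-allFin i))
    ∈-dartsAt (w ∷ vs) (there v∈vs) i = ∈-++⁺ʳ (map (dart w) (allFin (deg w))) (∈-dartsAt vs v∈vs i)

    darts : List (Dart n deg)
    darts = dartsAt (allFin n)

    ∈-darts : ∀ d → d ∈ darts
    ∈-darts (v , i) = ∈-dartsAt (allFin n) (∈-allFin v) i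

    dart-index : Dart n deg → Fin (length darts)
    dart-index d = index (∈-darts d)

    dart-index-injective : ∀ {x y} → dart-index x ≡ dart-index y → x ≡ y
    dart-index-injective {x} {y} eq =
      trans (lookup-index (∈-darts x)) (trans (cong (lookup darts) eq) (sym (lookup-index (∈-darts y))))

    length-darts : length darts ≡ n′ + n′
    length-darts = trans (length-dartsAt (allFin n))
      (suc-injective (suc-injective (trans (+-comm 2 (sumDeg deg)) (trans edge-count
        (cong suc (trans (cong (λ x → n′ + x) (cong suc (+-identityʳ n′))) (+-suc n′ n′)))))))

    edge-dart : Fin n′ ⊎ Fin n′ → Dart n deg
    edge-dart = [ (λ i → parentDart (punchIn r i)) , (λ i → β (parentDart (punchIn r i))) ]′

    punchIn≢r : ∀ i → punchIn r i ≢ r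
    punchIn≢r = punchInᵢ≢i r

    edge-dart-injective : ∀ s s′ → edge-dart s ≡ edge-dart s′ → s ≡ s′
    edge-dart-injective (inj₁ i) (inj₁ i′) eq =
      cong inj₁ (punchIn-injective r i i′ (parentDart-injective (punchIn≢r i) (punchIn≢r i′) eq))
    edge-dart-injective (inj₁ i) (inj₂ i′) eq = ⊥-elim (parentDart≢opposite (punchIn≢r i) (punchIn≢r i′) eq)
    edge-dart-injective (inj₂ i) (inj₁ i′) eq = ⊥-elim (parentDart≢opposite (punchIn≢r i′) (punchIn≢r i) (sym eq))
    edge-dart-injective (inj₂ i) (inj₂ i′) eq =
      cong inj₂ (punchIn-injective r i i′ (parentDart-injective (punchIn≢r i) (punchIn≢r i′) (β-injective eq)))

    edge-dart-on-parent-edge : ∀ s → OnParentEdge (edge-dart s)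
    edge-dart-on-parent-edge (inj₁ i) = punchIn r i , punchIn≢r i , inj₁ refl
    edge-dart-on-parent-edge (inj₂ i) = punchIn r i , punchIn≢r i , inj₂ refl

  -- The 2n′ darts of the n′ parent edges are pairwise distinct and there are only 2n′ darts.
  opaque
    on-parent-edge : ∀ d → OnParentEdge d
    on-parent-edge d with any? (λ c → ¬? (c ≟F r) ×-dec ((d ≟D parentDart c) ⊎-dec (d ≟D β (parentDart c))))
    ... | yes on = on
    ... | no off = ⊥-elim (<-irrefl refl (subst (suc (n′ + n′) ≤_) length-darts
                                                (injective⇒≤ {f = dart-index ∘ extended} extended-injective)))
      where
      extended : Fin (suc (n′ + n′)) → Dart n deg
      extended zero = d
      extended (suc k) = edge-dart (splitAt n′ k)

      extended-injective : ∀ {k k′} → dart-index (extended k) ≡ dart-index (extended k′) → k ≡ k′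
      extended-injective {zero} {zero} _ = refl
      extended-injective {zero} {suc k′} eq =
        ⊥-elim (off (subst OnParentEdge (sym (dart-index-injective eq)) (edge-dart-on-parent-edge (splitAt n′ k′))))
      extended-injective {suc k} {zero} eq =
        ⊥-elim (off (subst OnParentEdge (dart-index-injective eq) (edge-dart-on-parent-edge (splitAt n′ k))))
      extended-injective {suc k} {suc k′} eq = cong suc (trans (sym (join-splitAt n′ n′ k))
        (trans (cong (join n′ n′) (edge-dart-injective (splitAt n′ k) (splitAt n′ k′) (dart-index-injective eq)))
               (join-splitAt n′ n′ k′)))

  infix 4 _≽_
  data _≽_ (w : Fin n) : Fin n → Set where
    here : w ≽ w
    below : ∀ {v} → v ≢ r → w ≽ parent v → w ≽ v

  ≽⇒depth≤ : ∀ {w v} → w ≽ v → depth w ≤ depth v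
  ≽⇒depth≤ here = ≤-refl
  ≽⇒depth≤ (below v≢r w≽pv) = ≤-trans (≽⇒depth≤ w≽pv) (<⇒≤ (depth-parent< v≢r))

  ≽-parent : ∀ {w v} → w ≽ v → v ≢ w → v ≢ r × w ≽ parent v
  ≽-parent here v≢w = ⊥-elim (v≢w refl)
  ≽-parent (below v≢r w≽pv) _ = v≢r , w≽pv

  ≽⇒depth< : ∀ {w v} → w ≽ v → v ≢ w → depth w < depth v
  ≽⇒depth< w≽v v≢w = let (v≢r , w≽pv) = ≽-parent w≽v v≢w in ≤-<-trans (≽⇒depth≤ w≽pv) (depth-parent< v≢r)

  ≽-trans : ∀ {a b c} → a ≽ b → b ≽ c → a ≽ c
  ≽-trans a≽b here = a≽b
  ≽-trans a≽b (below c≢r b≽pc) = below c≢r (≽-trans a≽b b≽pc)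

  ≽-antisym : ∀ {a b} → a ≽ b → b ≽ a → a ≡ b
  ≽-antisym {a} {b} a≽b b≽a with b ≟F a
  ... | yes b≡a = sym b≡a
  ... | no b≢a = ⊥-elim (<-irrefl refl (<-≤-trans (≽⇒depth< a≽b b≢a) (≽⇒depth≤ b≽a)))

  ≽-linear : ∀ {w₁ w₂ v} → w₁ ≽ v → w₂ ≽ v → w₁ ≽ w₂ ⊎ w₂ ≽ w₁
  ≽-linear here w₂≽v = inj₂ w₂≽v
  ≽-linear (below v≢r w₁≽pv) here = inj₁ (below v≢r w₁≽pv)
  ≽-linear (below _ w₁≽pv) (below _ w₂≽pv) = ≽-linear w₁≽pv w₂≽pv

  ¬≽parent : ∀ {v} → v ≢ r → ¬ v ≽ parent v
  ¬≽parent v≢r v≽pv = <-irrefl refl (≤-<-trans (≽⇒depth≤ v≽pv) (depth-parent< v≢r))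

  parent-≢ : ∀ {c} → c ≢ r → parent c ≢ c
  parent-≢ c≢r pc≡c = <-irrefl (cong depth pc≡c) (depth-parent< c≢r)

  parent⇒≽ : ∀ {c w} → c ≢ r → parent c ≡ w → w ≽ c
  parent⇒≽ c≢r pc≡w = below c≢r (subst (_ ≽_) (sym pc≡w) here)

  root-≽ : ∀ v → r ≽ v
  root-≽ v = go (suc (depth v)) v (n<1+n (depth v))
    where
    go : ∀ k v → depth v < k → r ≽ v
    go (suc k) v (s≤s depth≤k) with v ≟F r
    ... | yes refl = here
    ... | no v≢r = below v≢r (go k (parent v) (<-≤-trans (depth-parent< v≢r) depth≤k))

  ≽-non-root : ∀ {w v} → w ≢ r → w ≽ v → v ≢ r
  ≽-non-root w≢r w≽v refl = w≢r (≽-antisym w≽v (root-≽ _))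

  ancestor-of-parent-≢ : ∀ {c m q} → q ≢ r → parent q ≡ m → c ≽ m → c ≢ q
  ancestor-of-parent-≢ q≢r pq≡m c≽m refl = parent-≢ q≢r (trans pq≡m (≽-antisym (parent⇒≽ q≢r pq≡m) c≽m))

  opaque
    child-towards : ∀ {w x} → w ≽ x → x ≢ w → Σ (Fin n) λ c → c ≢ r × parent c ≡ w × c ≽ x
    child-towards here x≢w = ⊥-elim (x≢w refl)
    child-towards {w} (below {v} v≢r w≽pv) _ with parent v ≟F w
    ... | yes pv≡w = v , v≢r , pv≡w , here
    ... | no pv≢w = let (c , c≢r , pc≡w , c≽pv) = child-towards w≽pv pv≢w in c , c≢r , pc≡w , below v≢r c≽pv

  siblings-disjoint : ∀ {c₁ c₂ v} → c₁ ≢ r → c₂ ≢ r → parent c₁ ≡ parent c₂ → c₁ ≽ v → c₂ ≽ v → c₁ ≡ c₂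
  siblings-disjoint {c₁} {c₂} c₁≢r c₂≢r same c₁≽v c₂≽v with ≽-linear c₁≽v c₂≽v
  ... | inj₁ c₁≽c₂ with c₂ ≟F c₁
  ...   | yes c₂≡c₁ = sym c₂≡c₁
  ...   | no c₂≢c₁ = ⊥-elim (¬≽parent c₁≢r (subst (c₁ ≽_) (sym same) (proj₂ (≽-parent c₁≽c₂ c₂≢c₁))))
  siblings-disjoint {c₁} {c₂} c₁≢r c₂≢r same c₁≽v c₂≽v | inj₂ c₂≽c₁ with c₁ ≟F c₂
  ...   | yes c₁≡c₂ = c₁≡c₂
  ...   | no c₁≢c₂ = ⊥-elim (¬≽parent c₂≢r (subst (c₂ ≽_) same (proj₂ (≽-parent c₂≽c₁ c₁≢c₂))))

  opaque
    child-at : ∀ {v} d → proj₁ d ≡ v → d ≢ parentDart v → Σ (Fin n) λ c → c ≢ r × β (parentDart c) ≡ d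
    child-at d d-at-v not-parent with on-parent-edge d
    ... | c , c≢r , inj₂ eq = c , c≢r , sym eq
    ... | c , c≢r , inj₁ eq =
      ⊥-elim (not-parent (trans eq (cong parentDart (trans (sym (parentDart-source c≢r)) (trans (cong proj₁ (sym eq)) d-at-v)))))

  deg1-dart-unique : ∀ {v} → deg v ≡ 1 → (x y : Dart n deg) → proj₁ x ≡ v → proj₁ y ≡ v → x ≡ y
  deg1-dart-unique deg≡1 (a , i) (b , j) refl refl = cong (a ,_) (Fin1-unique deg≡1 i j)

  leaf-childless : ∀ {v c} → v ≢ r → deg v ≡ 1 → c ≢ r → parent c ≢ v
  leaf-childless v≢r deg≡1 c≢r pc≡v =
    parentDart≢opposite v≢r c≢r (deg1-dart-unique deg≡1 _ _ (parentDart-source v≢r) pc≡v)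

  leaf-≽⇒≡ : ∀ {v x} → v ≢ r → deg v ≡ 1 → v ≽ x → x ≡ v
  leaf-≽⇒≡ {v} {x} v≢r deg≡1 v≽x with x ≟F v
  ... | yes x≡v = x≡v
  ... | no x≢v = let (c , c≢r , pc≡v , _) = child-towards v≽x x≢v in ⊥-elim (leaf-childless v≢r deg≡1 c≢r pc≡v)

  leaf-¬≽parent : ∀ {x y} → x ≢ r → deg x ≡ 1 → y ≢ r → ¬ x ≽ parent y
  leaf-¬≽parent x≢r deg≡1 y≢r x≽py = leaf-childless x≢r deg≡1 y≢r (leaf-≽⇒≡ x≢r deg≡1 x≽py)

  deg≥1 : ∀ {v} → v ≢ r → 1 ≤ deg v
  deg≥1 {v} v≢r = ≤-<-trans z≤n (toℕ<n (proj₁ (parentDart-at v v≢r)))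

  opaque
    child-exists : ∀ {w} → w ≢ r → 2 ≤ deg w → Σ (Fin n) λ c → c ≢ r × parent c ≡ w
    child-exists {w} w≢r 2≤deg =
      let (i , pd≡i) = parentDart-at w w≢r
          (j , j≢i) = ∃-≢ 2≤deg i
          (c , c≢r , eq) = child-at (w , j) refl (λ eq′ → j≢i (position-injective (trans eq′ pd≡i)))
      in c , c≢r , cong proj₁ eq

  record ChildrenAfterParent (w : Fin n) : Set where
    field
      child₁ child₂ : Fin n
      child₁≢r : child₁ ≢ r
      child₂≢r : child₂ ≢ r
      child₁-at : β (parentDart child₁) ≡ σ (parentDart w)
      child₂-at : β (parentDart child₂) ≡ σ (σ (parentDart w))

  children-after-parent : ∀ {w} → w ≢ r → 3 ≤ deg w → ChildrenAfterParent w
  children-after-parent {w} w≢r 3≤deg =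
    let 3≤deg′ = subst (λ v → 3 ≤ deg v) (sym (parentDart-source w≢r)) 3≤deg
        (c₁ , c₁≢r , at₁) = child-at (σ (parentDart w)) (parentDart-source w≢r)
                                     (σ-≢ (parentDart w) (≤-trans (n≤1+n 2) 3≤deg′))
        (c₂ , c₂≢r , at₂) = child-at (σ (σ (parentDart w))) (parentDart-source w≢r) (σ²-≢ (parentDart w) 3≤deg′)
    in record { child₁ = c₁ ; child₂ = c₂ ; child₁≢r = c₁≢r ; child₂≢r = c₂≢r ; child₁-at = at₁ ; child₂-at = at₂ }

  module _ {w : Fin n} (w≢r : w ≢ r) (3≤deg : 3 ≤ deg w) (children : ChildrenAfterParent w) where
    open ChildrenAfterParent children

    parent-child₁ : parent child₁ ≡ w
    parent-child₁ = trans (cong proj₁ child₁-at) (parentDart-source w≢r)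

    parent-child₂ : parent child₂ ≡ w
    parent-child₂ = trans (cong proj₁ child₂-at) (parentDart-source w≢r)

    child₁≢child₂ : child₁ ≢ child₂
    child₁≢child₂ c₁≡c₂ = σ-≢ (σ (parentDart w)) (subst (λ v → 2 ≤ deg v) (sym (parentDart-source w≢r)) (≤-trans (n≤1+n 2) 3≤deg))
      (sym (trans (sym child₁-at) (trans (cong (λ c → β (parentDart c)) c₁≡c₂) child₂-at)))

  private
    max-depth : ℕ
    max-depth = foldr (λ v acc → depth v ⊔ acc) 0 (allFin n)

    depth≤max : ∀ v → depth v ≤ max-depth
    depth≤max v = go (allFin n) (∈-allFin v)
      where
      go : ∀ xs → v ∈ xs → depth v ≤ foldr (λ v acc → depth v ⊔ acc) 0 xs
      go (x ∷ xs) (here refl) = m≤m⊔n (depth x) _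
      go (x ∷ xs) (there v∈xs) = ≤-trans (go xs v∈xs) (m≤n⊔m (depth x) _)

  record LeafBelow (v : Fin n) : Set where
    field
      leaf : Fin n
      ≽leaf : v ≽ leaf
      deg-leaf : deg leaf ≡ 1

  -- The fuel suffices: depths grow along the descent and are bounded by max-depth.
  opaque
    leaf-below : ∀ v → v ≢ r → LeafBelow v
    leaf-below v v≢r = go (suc max-depth) v v≢r (subst (max-depth <_) (sym (+-suc (depth v) max-depth))
                                                         (s≤s (m≤n+m max-depth (depth v))))
      where
      go : ∀ fuel w → w ≢ r → max-depth < depth w + fuel → LeafBelow w
      go zero w _ lt = ⊥-elim (<-irrefl refl (≤-<-trans (depth≤max w) (subst (max-depth <_) (+-identityʳ (depth w)) lt)))
      go (suc fuel) w w≢r lt with deg w ≟ 1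
      ... | yes deg≡1 = record { leaf = w ; ≽leaf = here ; deg-leaf = deg≡1 }
      ... | no deg≢1 =
        let (c , c≢r , pc≡w) = child-exists w≢r (1≤≢1⇒2≤ (deg≥1 w≢r) deg≢1)
            w≽c = parent⇒≽ c≢r pc≡w
            dw<dc = ≽⇒depth< w≽c (λ c≡w → parent-≢ c≢r (trans pc≡w (sym c≡w)))
            lt′ = ≤-trans lt (subst (_≤ depth c + fuel) (sym (+-suc (depth w) fuel)) (+-monoˡ-≤ fuel dw<dc))
            below-c = go fuel c c≢r lt′
        in record { leaf = LeafBelow.leaf below-c ; ≽leaf = ≽-trans w≽c (LeafBelow.≽leaf below-c)
                  ; deg-leaf = LeafBelow.deg-leaf below-c }

  opaque
    _≽?_ : ∀ w v → Dec (w ≽ v)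
    w ≽? v = go (suc (depth v)) v (n<1+n (depth v))
      where
      go : ∀ k v → depth v < k → Dec (w ≽ v)
      go (suc k) v (s≤s depth≤k) with v ≟F w
      ... | yes refl = yes here
      ... | no v≢w with v ≟F r
      ...   | yes refl = no (λ w≽v → proj₁ (≽-parent w≽v v≢w) refl)
      ...   | no v≢r with go k (parent v) (<-≤-trans (depth-parent< v≢r) depth≤k)
      ...     | yes w≽pv = yes (below v≢r w≽pv)
      ...     | no w⋡pv = no (λ w≽v → w⋡pv (proj₂ (≽-parent w≽v v≢w)))

  module Rewired (α′ : Dart n deg → Dart n deg) (α′-invol : ∀ d → α′ (α′ d) ≡ d) where

    KeepsParentEdge : Fin n → Set
    KeepsParentEdge c = α′ (parentDart c) ≡ β (parentDart c)

    Walk : Fin n → Fin n → Set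
    Walk = Star (Adj α′)

    reverse : ∀ {a b} → Walk a b → Walk b a
    reverse ε = ε
    reverse {a} ((i , α′ai≡x) ◅ walk) =
      reverse walk ◅◅ (subst (λ x → Adj α′ x a) α′ai≡x (proj₂ (α′ (a , i)) , cong proj₁ (α′-invol (a , i))) ◅ ε)

    along : ∀ {v} (d : Dart n deg) → proj₁ d ≡ v → Walk v (proj₁ (α′ d))
    along (v , i) refl = (i , refl) ◅ ε

    along-to : ∀ {v w} (d : Dart n deg) → proj₁ d ≡ v → proj₁ (α′ d) ≡ w → Walk v w
    along-to d d-at-v α′d-at-w = subst (Walk _) α′d-at-w (along d d-at-v)

    to-parent : ∀ {v} → v ≢ r → KeepsParentEdge v → Walk v (parent v)
    to-parent v≢r keeps = along-to (parentDart _) (parentDart-source v≢r) (cong proj₁ keeps)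

    climb : ∀ {w v} → w ≽ v → (∀ c → c ≽ v → w ≽ c → c ≢ w → KeepsParentEdge c) → Walk v w
    climb here _ = ε
    climb {w} {v} (below v≢r w≽pv) keeps =
      to-parent v≢r (keeps v here (below v≢r w≽pv) v≢w) ◅◅ climb w≽pv (λ c c≽pv → keeps c (below v≢r c≽pv))
      where
      v≢w : v ≢ w
      v≢w refl = ¬≽parent v≢r w≽pv

    opaque
      connected-if : (∀ v → v ≢ r → KeepsParentEdge v ⊎ Walk v r) → ∀ v w → Walk v w
      connected-if reach v w = to-root v ◅◅ reverse (to-root w)
        where
        to-root : ∀ v → Walk v r
        to-root v = go (suc (depth v)) v (n<1+n (depth v))
          where
          go : ∀ k v → depth v < k → Walk v r
          go (suc k) v (s≤s depth≤k) with v ≟F r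
          ... | yes refl = ε
          ... | no v≢r with reach v v≢r
          ...   | inj₂ walk = walk
          ...   | inj₁ keeps = to-parent v≢r keeps ◅◅ go k (parent v) (<-≤-trans (depth-parent< v≢r) depth≤k)

  -- Glue and cut with the leaves a, b and the edge between q and its parent m:
  -- afterwards a hangs at m in the place of q, and b hangs at q.
  module OneGlueCut {m q a b : Fin n} (q≢r : q ≢ r) (pq≡m : parent q ≡ m)
    (a≢r : a ≢ r) (b≢r : b ≢ r) (deg-a : deg a ≡ 1) (deg-b : deg b ≡ 1) (a≢m : a ≢ m)
    (q≽b : q ≽ b) (b≢q : b ≢ q) (q⋡a : ¬ q ≽ a) where

    a≢b : a ≢ b
    a≢b refl = q⋡a q≽b

    a≢q : a ≢ q
    a≢q refl = q⋡a here

    b≢m : b ≢ m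
    b≢m refl = parent-≢ q≢r (trans pq≡m (≽-antisym (parent⇒≽ q≢r pq≡m) q≽b))

    la lb e : Dart n deg
    la = parentDart a
    lb = parentDart b
    e = β (parentDart q)

    β-e≡pd-q : β e ≡ parentDart q
    β-e≡pd-q = β-invol (parentDart q)

    la≢lb : la ≢ lb
    la≢lb = parentDart-≢ a≢r b≢r a≢b
    βla≢lb : β la ≢ lb
    βla≢lb = opposite≢parentDart a≢r b≢r
    la≢e : la ≢ e
    la≢e = parentDart≢opposite a≢r q≢r
    la≢βe : la ≢ β e
    la≢βe eq = parentDart-≢ a≢r q≢r a≢q (trans eq β-e≡pd-q)
    lb≢e : lb ≢ e
    lb≢e = parentDart≢opposite b≢r q≢r
    lb≢βe : lb ≢ β e
    lb≢βe eq = parentDart-≢ b≢r q≢r b≢q (trans eq β-e≡pd-q)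

    open GlueCutInvolution β β-invol β-nofix la lb e la≢lb βla≢lb la≢e la≢βe lb≢e lb≢βe public

    keeps-parent-edge : ∀ {v} → v ≢ r → v ≢ a → v ≢ b → v ≢ q → g (parentDart v) ≡ β (parentDart v)
    keeps-parent-edge v≢r v≢a v≢b v≢q =
      g-other (parentDart-≢ v≢r a≢r v≢a) (parentDart-≢ v≢r b≢r v≢b) (parentDart≢opposite v≢r a≢r)
              (parentDart≢opposite v≢r b≢r) (parentDart≢opposite v≢r q≢r)
              (λ eq → parentDart-≢ v≢r q≢r v≢q (trans eq β-e≡pd-q))

    g-pd-b : g lb ≡ parentDart q
    g-pd-b = trans g-lb β-e≡pd-q

    open Rewired g involutive

    walk-m-root : Walk m r
    walk-m-root = climb (root-≽ m) keeps
      where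
      keeps : ∀ c → c ≽ m → r ≽ c → c ≢ r → KeepsParentEdge c
      keeps c c≽m _ c≢r = keeps-parent-edge c≢r (λ { refl → a≢m (sym (leaf-≽⇒≡ a≢r deg-a c≽m)) })
        (λ { refl → b≢m (sym (leaf-≽⇒≡ b≢r deg-b c≽m)) }) (ancestor-of-parent-≢ q≢r pq≡m c≽m)

    walk-pb-q : Walk (parent b) q
    walk-pb-q = climb (proj₂ (≽-parent q≽b b≢q)) keeps
      where
      keeps : ∀ c → c ≽ parent b → q ≽ c → c ≢ q → KeepsParentEdge c
      keeps c c≽pb q≽c c≢q =
        keeps-parent-edge (≽-non-root q≢r q≽c) (λ { refl → q⋡a q≽c }) (λ { refl → ¬≽parent b≢r c≽pb }) c≢q

    walk-pa-root : Walk (parent a) r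
    walk-pa-root = climb (root-≽ (parent a)) keeps
      where
      keeps : ∀ c → c ≽ parent a → r ≽ c → c ≢ r → KeepsParentEdge c
      keeps c c≽pa _ c≢r = keeps-parent-edge c≢r (λ { refl → ¬≽parent a≢r c≽pa })
        (λ { refl → leaf-¬≽parent b≢r deg-b a≢r c≽pa }) (λ { refl → q⋡a (below a≢r c≽pa) })

    walk-q-root : Walk q r
    walk-q-root = reverse walk-pb-q ◅◅ along-to (β lb) refl (cong proj₁ g-B) ◅◅ walk-pa-root

    walk-a-root : Walk a r
    walk-a-root = along-to la (parentDart-source a≢r) (trans (cong proj₁ g-la) pq≡m) ◅◅ walk-m-root

    walk-b-root : Walk b r
    walk-b-root = along-to lb (parentDart-source b≢r) (trans (cong proj₁ g-pd-b) (parentDart-source q≢r)) ◅◅ walk-q-root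

    reach : ∀ v → v ≢ r → KeepsParentEdge v ⊎ Walk v r
    reach v v≢r = by-cases (v ≟F a) (v ≟F b) (v ≟F q)
      where
      by-cases : Dec (v ≡ a) → Dec (v ≡ b) → Dec (v ≡ q) → KeepsParentEdge v ⊎ Walk v r
      by-cases (yes v≡a) _ _ = inj₂ (subst (λ x → Walk x r) (sym v≡a) walk-a-root)
      by-cases (no _) (yes v≡b) _ = inj₂ (subst (λ x → Walk x r) (sym v≡b) walk-b-root)
      by-cases (no _) (no _) (yes v≡q) = inj₂ (subst (λ x → Walk x r) (sym v≡q) walk-q-root)
      by-cases (no v≢a) (no v≢b) (no v≢q) = inj₁ (keeps-parent-edge v≢r v≢a v≢b v≢q)

    tree′ : PlaneTree n deg
    tree′ = record { α = g ; α-invol = involutive ; α-nofix = fixpoint-free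
                   ; connected = connected-if reach ; edges = edge-count }

  -- Two glue-and-cuts at sibling children q₁, q₂ of m: first a replaces q₁ and b hangs at q₁,
  -- then b replaces q₂ and b′ hangs at q₂.
  module TwoGlueCuts {m q₁ q₂ a b b′ : Fin n}
    (q₁≢r : q₁ ≢ r) (pq₁≡m : parent q₁ ≡ m) (q₂≢r : q₂ ≢ r) (pq₂≡m : parent q₂ ≡ m) (q₁≢q₂ : q₁ ≢ q₂)
    (a≢r : a ≢ r) (b≢r : b ≢ r) (b′≢r : b′ ≢ r) (deg-a : deg a ≡ 1) (deg-b : deg b ≡ 1) (deg-b′ : deg b′ ≡ 1)
    (a≢m : a ≢ m) (q₁≽b : q₁ ≽ b) (b≢q₁ : b ≢ q₁) (q₁⋡a : ¬ q₁ ≽ a)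
    (q₂≽b′ : q₂ ≽ b′) (b′≢q₂ : b′ ≢ q₂) (q₂⋡a : ¬ q₂ ≽ a) where

    module First = OneGlueCut q₁≢r pq₁≡m a≢r b≢r deg-a deg-b a≢m q₁≽b b≢q₁ q₁⋡a

    g₁ : Dart n deg → Dart n deg
    g₁ = First.g

    private
      siblings : parent q₁ ≡ parent q₂
      siblings = trans pq₁≡m (sym pq₂≡m)

      q₂⋡b : ¬ q₂ ≽ b
      q₂⋡b q₂≽b = q₁≢q₂ (siblings-disjoint q₁≢r q₂≢r siblings q₁≽b q₂≽b)
      q₁⋡b′ : ¬ q₁ ≽ b′
      q₁⋡b′ q₁≽b′ = q₁≢q₂ (siblings-disjoint q₁≢r q₂≢r siblings q₁≽b′ q₂≽b′)
      q₂⋡q₁ : ¬ q₂ ≽ q₁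
      q₂⋡q₁ q₂≽q₁ = q₁≢q₂ (siblings-disjoint q₁≢r q₂≢r siblings here q₂≽q₁)
      q₁⋡q₂ : ¬ q₁ ≽ q₂
      q₁⋡q₂ q₁≽q₂ = q₁≢q₂ (siblings-disjoint q₁≢r q₂≢r siblings q₁≽q₂ here)

      a≢b′ : a ≢ b′
      a≢b′ refl = q₂⋡a q₂≽b′
      a≢q₁ : a ≢ q₁
      a≢q₁ refl = q₁⋡a here
      a≢q₂ : a ≢ q₂
      a≢q₂ refl = q₂⋡a here
      b≢q₂ : b ≢ q₂
      b≢q₂ refl = q₁⋡q₂ q₁≽b
      b′≢q₁ : b′ ≢ q₁
      b′≢q₁ refl = q₂⋡q₁ q₂≽b′
      b′≢m : b′ ≢ m
      b′≢m refl = parent-≢ q₂≢r (trans pq₂≡m (≽-antisym (parent⇒≽ q₂≢r pq₂≡m) q₂≽b′))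

    b≢b′ : b ≢ b′
    b≢b′ refl = q₂⋡b q₂≽b′

    g₁-e : g₁ (β (parentDart q₂)) ≡ parentDart q₂
    g₁-e = trans (First.g-other (opposite≢parentDart q₂≢r a≢r) (opposite≢parentDart q₂≢r b≢r)
                                (opposite-parentDart-≢ q₂≢r a≢r (≢-sym a≢q₂)) (opposite-parentDart-≢ q₂≢r b≢r (≢-sym b≢q₂))
                                (opposite-parentDart-≢ q₂≢r q₁≢r (≢-sym q₁≢q₂))
                                (λ eq → opposite≢parentDart q₂≢r q₁≢r (trans eq (β-invol (parentDart q₁)))))
                 (β-invol (parentDart q₂))

    g₁-pd-b′ : g₁ (parentDart b′) ≡ β (parentDart b′)
    g₁-pd-b′ = First.keeps-parent-edge b′≢r (≢-sym a≢b′) (≢-sym b≢b′) b′≢q₁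

    la≢lb : parentDart b ≢ parentDart b′
    la≢lb = parentDart-≢ b≢r b′≢r b≢b′
    g₁la≢lb : g₁ (parentDart b) ≢ parentDart b′
    g₁la≢lb eq = parentDart-≢ q₁≢r b′≢r (≢-sym b′≢q₁) (trans (sym First.g-pd-b) eq)
    la≢e : parentDart b ≢ β (parentDart q₂)
    la≢e = parentDart≢opposite b≢r q₂≢r
    la≢g₁e : parentDart b ≢ g₁ (β (parentDart q₂))
    la≢g₁e eq = parentDart-≢ b≢r q₂≢r b≢q₂ (trans eq g₁-e)
    lb≢e : parentDart b′ ≢ β (parentDart q₂)
    lb≢e = parentDart≢opposite b′≢r q₂≢r
    lb≢g₁e : parentDart b′ ≢ g₁ (β (parentDart q₂))
    lb≢g₁e eq = parentDart-≢ b′≢r q₂≢r b′≢q₂ (trans eq g₁-e)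

    module Second = GlueCutInvolution g₁ First.involutive First.fixpoint-free
      (parentDart b) (parentDart b′) (β (parentDart q₂)) la≢lb g₁la≢lb la≢e la≢g₁e lb≢e lb≢g₁e

    g : Dart n deg → Dart n deg
    g = Second.g

    private
      second-other : ∀ {v} → v ≢ r → v ≢ b → v ≢ b′ → v ≢ q₁ → v ≢ q₂ → g₁ (parentDart v) ≡ β (parentDart v) →
                     g (parentDart v) ≡ g₁ (parentDart v)
      second-other v≢r v≢b v≢b′ v≢q₁ v≢q₂ g₁-keeps =
        Second.g-other (parentDart-≢ v≢r b≢r v≢b) (parentDart-≢ v≢r b′≢r v≢b′)
                       (λ eq → parentDart-≢ v≢r q₁≢r v≢q₁ (trans eq First.g-pd-b))
                       (λ eq → parentDart≢opposite v≢r b′≢r (trans eq g₁-pd-b′))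
                       (parentDart≢opposite v≢r q₂≢r) (λ eq → parentDart-≢ v≢r q₂≢r v≢q₂ (trans eq g₁-e))

    keeps-parent-edge : ∀ {v} → v ≢ r → v ≢ a → v ≢ b → v ≢ b′ → v ≢ q₁ → v ≢ q₂ →
                        g (parentDart v) ≡ β (parentDart v)
    keeps-parent-edge v≢r v≢a v≢b v≢b′ v≢q₁ v≢q₂ =
      trans (second-other v≢r v≢b v≢b′ v≢q₁ v≢q₂ g₁-keeps) g₁-keeps
      where g₁-keeps = First.keeps-parent-edge v≢r v≢a v≢b v≢q₁

    g-pd-a : g (parentDart a) ≡ β (parentDart q₁)
    g-pd-a = trans (Second.g-other (parentDart-≢ a≢r b≢r First.a≢b) (parentDart-≢ a≢r b′≢r a≢b′)
                     (λ eq → parentDart-≢ a≢r q₁≢r a≢q₁ (trans eq First.g-pd-b))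
                     (λ eq → parentDart≢opposite a≢r b′≢r (trans eq g₁-pd-b′))
                     (parentDart≢opposite a≢r q₂≢r) (λ eq → parentDart-≢ a≢r q₂≢r a≢q₂ (trans eq g₁-e)))
                   First.g-la

    g-pd-b : g (parentDart b) ≡ β (parentDart q₂)
    g-pd-b = Second.g-la

    g-pd-b′ : g (parentDart b′) ≡ parentDart q₂
    g-pd-b′ = trans Second.g-lb g₁-e

    g-opp-b : g (β (parentDart b)) ≡ β (parentDart a)
    g-opp-b = trans (Second.g-other (β-nofix (parentDart b)) (opposite≢parentDart b≢r b′≢r)
                      (λ eq → opposite≢parentDart b≢r q₁≢r (trans eq First.g-pd-b))
                      (λ eq → opposite-parentDart-≢ b≢r b′≢r b≢b′ (trans eq g₁-pd-b′))
                      (opposite-parentDart-≢ b≢r q₂≢r b≢q₂)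
                      (λ eq → opposite≢parentDart b≢r q₂≢r (trans eq g₁-e)))
                    First.g-B

    g-opp-b′ : g (β (parentDart b′)) ≡ parentDart q₁
    g-opp-b′ = trans (cong g (sym g₁-pd-b′)) (trans Second.g-B First.g-pd-b)

    open Rewired g Second.involutive

    walk-m-root : Walk m r
    walk-m-root = climb (root-≽ m) keeps
      where
      keeps : ∀ c → c ≽ m → r ≽ c → c ≢ r → KeepsParentEdge c
      keeps c c≽m _ c≢r = keeps-parent-edge c≢r (λ { refl → a≢m (sym (leaf-≽⇒≡ a≢r deg-a c≽m)) })
        (λ { refl → First.b≢m (sym (leaf-≽⇒≡ b≢r deg-b c≽m)) }) (λ { refl → b′≢m (sym (leaf-≽⇒≡ b′≢r deg-b′ c≽m)) })
        (ancestor-of-parent-≢ q₁≢r pq₁≡m c≽m) (ancestor-of-parent-≢ q₂≢r pq₂≡m c≽m)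

    walk-pb-q₁ : Walk (parent b) q₁
    walk-pb-q₁ = climb (proj₂ (≽-parent q₁≽b b≢q₁)) keeps
      where
      keeps : ∀ c → c ≽ parent b → q₁ ≽ c → c ≢ q₁ → KeepsParentEdge c
      keeps c c≽pb q₁≽c c≢q₁ = keeps-parent-edge (≽-non-root q₁≢r q₁≽c) (λ { refl → q₁⋡a q₁≽c })
        (λ { refl → ¬≽parent b≢r c≽pb }) (λ { refl → q₁⋡b′ q₁≽c }) c≢q₁ (λ { refl → q₁⋡q₂ q₁≽c })

    walk-pb′-q₂ : Walk (parent b′) q₂
    walk-pb′-q₂ = climb (proj₂ (≽-parent q₂≽b′ b′≢q₂)) keeps
      where
      keeps : ∀ c → c ≽ parent b′ → q₂ ≽ c → c ≢ q₂ → KeepsParentEdge c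
      keeps c c≽pb′ q₂≽c c≢q₂ = keeps-parent-edge (≽-non-root q₂≢r q₂≽c) (λ { refl → q₂⋡a q₂≽c })
        (λ { refl → q₂⋡b q₂≽c }) (λ { refl → ¬≽parent b′≢r c≽pb′ }) (λ { refl → q₂⋡q₁ q₂≽c }) c≢q₂

    walk-pa-root : Walk (parent a) r
    walk-pa-root = climb (root-≽ (parent a)) keeps
      where
      keeps : ∀ c → c ≽ parent a → r ≽ c → c ≢ r → KeepsParentEdge c
      keeps c c≽pa _ c≢r = keeps-parent-edge c≢r (λ { refl → ¬≽parent a≢r c≽pa })
        (λ { refl → leaf-¬≽parent b≢r deg-b a≢r c≽pa }) (λ { refl → leaf-¬≽parent b′≢r deg-b′ a≢r c≽pa })
        (λ { refl → q₁⋡a (below a≢r c≽pa) }) (λ { refl → q₂⋡a (below a≢r c≽pa) })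

    walk-q₁-root : Walk q₁ r
    walk-q₁-root = reverse walk-pb-q₁ ◅◅ along-to (β (parentDart b)) refl (cong proj₁ g-opp-b) ◅◅ walk-pa-root

    walk-q₂-root : Walk q₂ r
    walk-q₂-root = reverse walk-pb′-q₂ ◅◅ along-to (β (parentDart b′)) refl
                     (trans (cong proj₁ g-opp-b′) (parentDart-source q₁≢r)) ◅◅ walk-q₁-root

    walk-a-root : Walk a r
    walk-a-root = along-to (parentDart a) (parentDart-source a≢r) (trans (cong proj₁ g-pd-a) pq₁≡m) ◅◅ walk-m-root

    walk-b-root : Walk b r
    walk-b-root = along-to (parentDart b) (parentDart-source b≢r) (trans (cong proj₁ g-pd-b) pq₂≡m) ◅◅ walk-m-root

    walk-b′-root : Walk b′ r
    walk-b′-root = along-to (parentDart b′) (parentDart-source b′≢r)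
                     (trans (cong proj₁ g-pd-b′) (parentDart-source q₂≢r)) ◅◅ walk-q₂-root

    reach : ∀ v → v ≢ r → KeepsParentEdge v ⊎ Walk v r
    reach v v≢r = by-cases (v ≟F a) (v ≟F b) (v ≟F b′) (v ≟F q₁) (v ≟F q₂)
      where
      by-cases : Dec (v ≡ a) → Dec (v ≡ b) → Dec (v ≡ b′) → Dec (v ≡ q₁) → Dec (v ≡ q₂) →
                 KeepsParentEdge v ⊎ Walk v r
      by-cases (yes v≡a) _ _ _ _ = inj₂ (subst (λ x → Walk x r) (sym v≡a) walk-a-root)
      by-cases (no _) (yes v≡b) _ _ _ = inj₂ (subst (λ x → Walk x r) (sym v≡b) walk-b-root)
      by-cases (no _) (no _) (yes v≡b′) _ _ = inj₂ (subst (λ x → Walk x r) (sym v≡b′) walk-b′-root)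
      by-cases (no _) (no _) (no _) (yes v≡q₁) _ = inj₂ (subst (λ x → Walk x r) (sym v≡q₁) walk-q₁-root)
      by-cases (no _) (no _) (no _) (no _) (yes v≡q₂) = inj₂ (subst (λ x → Walk x r) (sym v≡q₂) walk-q₂-root)
      by-cases (no v≢a) (no v≢b) (no v≢b′) (no v≢q₁) (no v≢q₂) =
        inj₁ (keeps-parent-edge v≢r v≢a v≢b v≢b′ v≢q₁ v≢q₂)

    tree″ : PlaneTree n deg
    tree″ = record { α = g ; α-invol = Second.involutive ; α-nofix = Second.fixpoint-free
                   ; connected = connected-if reach ; edges = edge-count }

L̄-of-degree : ∀ {n deg} → DecTree n deg → ℕ → Fin n → Bool
L̄-of-degree {deg = deg} T i v = not (L T v) ∧ (deg v ≡ᵇ i)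

module _ {n : ℕ} {deg : Fin n → ℕ} (T : DecTree n deg) {i : ℕ} {v : Fin n} where

  L̄-of-degree-intro : L T v ≡ false → deg v ≡ i → L̄-of-degree T i v ≡ true
  L̄-of-degree-intro L̄v deg≡i = cong₂ (λ b c → not b ∧ c) L̄v (dec-true (deg v ≟ i) deg≡i)

  L̄-of-degree-reject : deg v ≢ i → L̄-of-degree T i v ≡ false
  L̄-of-degree-reject deg≢i = trans (cong (not (L T v) ∧_) (dec-false (deg v ≟ i) deg≢i)) (∧-zeroʳ (not (L T v)))

  L̄-of-degree-elim : L̄-of-degree T i v ≡ true → L T v ≡ false × deg v ≡ i
  L̄-of-degree-elim holds with deg v ≟ i
  ... | no deg≢i = ⊥-elim (false≢true (trans (sym (L̄-of-degree-reject deg≢i)) holds))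
  ... | yes deg≡i with L T v
  ...   | false = refl , deg≡i
  ...   | true = ⊥-elim (false≢true holds)

steps-then-exchange : ∀ {n deg d g} {T T₀ T₁ : DecTree n deg} → Steps d g T T₀ → DecExchange T₀ T₁ → Steps (suc d) g T T₁
steps-then-exchange done ex = de ex done
steps-then-exchange (de ex′ steps) ex = de ex′ (steps-then-exchange steps ex)
steps-then-exchange (gc cut steps) ex = gc cut (steps-then-exchange steps ex)

module Exchange {n : ℕ} {deg : Fin n → ℕ} (T : DecTree n deg) {u : Fin n} (deg-u : deg u ≡ 1) (L̄u : L T u ≡ false)
  {x y : Dart n deg} (Lx : L T (proj₁ x) ≡ true) (Ly : L T (proj₁ y) ≡ true) (x≢y : proj₁ x ≢ proj₁ y)
  (adjacent : σ (α T x) ≡ α T y) where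

  private
    a : Fin n
    a = proj₁ x

    u≢a : u ≢ a
    u≢a u≡a = false≢true (trans (sym L̄u) (trans (cong (L T) u≡a) Lx))

    deg-a : deg a ≡ 1
    deg-a = L-leaf T a Lx

  L′ : Fin n → Bool
  L′ v = if does (v ≟F u) then true else if does (v ≟F a) then false else L T v

  L′-u : L′ u ≡ true
  L′-u rewrite dec-true (u ≟F u) refl = refl

  L′-a : L′ a ≡ false
  L′-a rewrite dec-false (a ≟F u) (≢-sym u≢a) | dec-true (a ≟F a) refl = refl

  L′-other : ∀ {v} → v ≢ u → v ≢ a → L′ v ≡ L T v
  L′-other {v} v≢u v≢a rewrite dec-false (v ≟F u) v≢u | dec-false (v ≟F a) v≢a = refl

  L′-leaf : ∀ v → L′ v ≡ true → deg v ≡ 1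
  L′-leaf v L′v with v ≟F u | v ≟F a
  ... | yes refl | _ = deg-u
  ... | no _ | yes refl = ⊥-elim (false≢true L′v)
  ... | no _ | no _ = L-leaf T v L′v

  exchanged : DecTree n deg
  exchanged = record { tree = tree T ; L = L′ ; L-leaf = L′-leaf }

  exchange : DecExchange T exchanged
  exchange = u , x , y , deg-u , L̄u , Lx , Ly , x≢y , inj₁ adjacent , (λ _ → refl) , L′-u , L′-a , λ v → L′-other

  mu-exchanged : ∀ i → mu exchanged i ≡ mu T i
  mu-exchanged i with i ≟ 1
  ... | yes refl = sym (count-exchange (L̄-of-degree T 1) (L̄-of-degree exchanged 1) u≢a
                     (λ v v≢u v≢a → cong (λ b → not b ∧ (deg v ≡ᵇ 1)) (sym (L′-other v≢u v≢a)))
                     (L̄-of-degree-intro T L̄u deg-u) (cong (λ b → not b ∧ (deg u ≡ᵇ 1)) L′-u)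
                     (cong (λ b → not b ∧ (deg a ≡ᵇ 1)) Lx) (L̄-of-degree-intro exchanged L′-a deg-a))
  ... | no i≢1 = count-cong (allFin n) same
    where
    same : ∀ v → L̄-of-degree exchanged i v ≡ L̄-of-degree T i v
    same v = by-cases (v ≟F u) (v ≟F a)
      where
      leaf-rejected : deg v ≡ 1 → L̄-of-degree exchanged i v ≡ L̄-of-degree T i v
      leaf-rejected deg≡1 = trans (L̄-of-degree-reject exchanged deg≢i) (sym (L̄-of-degree-reject T deg≢i))
        where deg≢i = λ deg≡i → i≢1 (trans (sym deg≡i) deg≡1)

      by-cases : Dec (v ≡ u) → Dec (v ≡ a) → L̄-of-degree exchanged i v ≡ L̄-of-degree T i v
      by-cases (yes v≡u) _ = leaf-rejected (trans (cong deg v≡u) deg-u)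
      by-cases (no _) (yes v≡a) = leaf-rejected (trans (cong deg v≡a) deg-a)
      by-cases (no v≢u) (no v≢a) = cong (λ b → not b ∧ (deg v ≡ᵇ i)) (L′-other v≢u v≢a)

  ell-exchanged : ell exchanged ≡ ell T
  ell-exchanged = count-exchange L′ (L T) u≢a (λ v v≢u v≢a → L′-other v≢u v≢a) L′-u L̄u L′-a Lx

  nice-exchanged : mu T 1 ≡ 1 → (∀ w → deg w ≤ deg (proj₁ (α T x))) → Nice exchanged
  nice-exchanged μ₁≡1 maximal = inj₂ (trans (mu-exchanged 1) μ₁≡1 , x , deg-a , L′-a , maximal)

private
  weight-term : (ℕ → ℕ) → ℕ → ℤ
  weight-term μ i = + μ i ℤ.* (+ i - + 2)

  weight-terms-vanish : ∀ (μ : ℕ → ℕ) t (f : ℕ → ℕ) → (∀ x → μ (f x) ≡ 0) →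
                        foldr ℤ._+_ (+ 0) (map (weight-term μ) (applyUpTo f t)) ≡ + 0
  weight-terms-vanish μ zero f _ = refl
  weight-terms-vanish μ (suc t) f vanish
    rewrite vanish 0 | weight-terms-vanish μ t (λ x → f (suc x)) (λ x → vanish (suc x)) = refl

  weight-of-degrees≤3 : ∀ (μ : ℕ → ℕ) t → μ 0 ≡ 0 → μ 1 ≡ 1 → (∀ i → 4 ≤ i → μ i ≡ 0) →
                        foldr ℤ._+_ (+ 0) (map (weight-term μ) (upTo (suc (3 + t)))) ≡ μ 3 ⊖ 1
  weight-of-degrees≤3 μ t μ₀ μ₁ μ≥4 = arithmetic (μ 0) (μ 1) (μ 2) (μ 3) _ μ₀ μ₁
    (weight-terms-vanish μ t (λ x → suc (suc (suc (suc x)))) (λ x → μ≥4 _ (s≤s (s≤s (s≤s (s≤s z≤n))))))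
    where
    arithmetic : ∀ a b c d (rest : ℤ) → a ≡ 0 → b ≡ 1 → rest ≡ + 0 →
      + a ℤ.* -[1+ 1 ] ℤ.+ (+ b ℤ.* -[1+ 0 ] ℤ.+ (+ c ℤ.* + 0 ℤ.+ (+ d ℤ.* + 1 ℤ.+ rest))) ≡ d ⊖ 1
    arithmetic .0 .1 c d .(+ 0) refl refl refl
      rewrite ℤₚ.*-zeroʳ (+ c) | ℤₚ.*-identityʳ (+ d) | +-identityʳ d = ℤₚ.+-identityˡ (d ⊖ 1)

-- With μ₀ = 0, μ₁ = 1 and no degree above 3, the weight condition reads μ₃ − 1 = k − 4.
μ₃≢1 : ∀ {n deg} (T : DecTree n deg) (k : ℕ) → weightSum T ≡ + k - + 4 →
       ¬ (k ≡ 4 × mu T 0 ≡ 0 × mu T 1 ≡ 1 × mu T 3 ≡ 1 × (∀ i → 4 ≤ i → mu T i ≡ 0)) →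
       mu T 1 ≡ 1 → mu T 0 ≡ 0 → (∀ i → 4 ≤ i → mu T i ≡ 0) → 3 ≤ sumDeg deg → mu T 3 ≢ 1
μ₃≢1 {deg = deg} T k weight ¬exceptional μ₁ μ₀ μ≥4 3≤S μ₃≡1 =
  ¬exceptional (⊖4≡0⇒≡4 k (trans (cong (_⊖ 1) (sym μ₃≡1)) (trans (sym weight≡μ₃⊖1) weight)) , μ₀ , μ₁ , μ₃≡1 , μ≥4)
  where
  weight≡μ₃⊖1 : weightSum T ≡ mu T 3 ⊖ 1
  weight≡μ₃⊖1 = let (t , 3+t≡S) = m≤n⇒∃[o]m+o≡n 3≤S in
    subst (λ S → foldr ℤ._+_ (+ 0) (map (weight-term (mu T)) (upTo (suc S))) ≡ mu T 3 ⊖ 1) 3+t≡S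
          (weight-of-degrees≤3 (mu T) t μ₀ μ₁ μ≥4)

  ⊖4≡0⇒≡4 : ∀ k → + 0 ≡ k ⊖ 4 → k ≡ 4
  ⊖4≡0⇒≡4 (suc (suc (suc (suc zero)))) _ = refl
  ⊖4≡0⇒≡4 (suc (suc (suc (suc (suc _))))) ()

ReachesNice : ∀ {n deg} → DecTree n deg → Set
ReachesNice {n} {deg} T = Σ ℕ λ d → Σ ℕ λ g → Σ (DecTree n deg) λ T′ →
  d ≤ 1 × g ≤ 2 × Steps d g T T′ × Nice T′ × (∀ i → mu T′ i ≡ mu T i) × ell T′ ≡ ell T

already-nice : ∀ {n deg} {T : DecTree n deg} → Nice T → ReachesNice T
already-nice {T = T} nice = 0 , 0 , T , z≤n , z≤n , done , nice , (λ _ → refl) , refl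

module SingleL̄Leaf {n′ : ℕ} {deg : Fin (suc n′) → ℕ} (T : DecTree (suc n′) deg)
  {u : Fin (suc n′)} (L̄u : L T u ≡ false) (deg-u : deg u ≡ 1)
  (only-L̄-leaf : ∀ v → L T v ≡ false → deg v ≡ 1 → v ≡ u) (μ₁≡1 : mu T 1 ≡ 1)
  (μ₃≢1 : mu T 0 ≡ 0 → (∀ i → 4 ≤ i → mu T i ≡ 0) → 3 ≤ sumDeg deg → mu T 3 ≢ 1) where

  root-dart : Fin (deg u)
  root-dart = subst Fin (sym deg-u) zero

  open Rooted (tree T) u root-dart

  withTree : PlaneTree n deg → DecTree n deg
  withTree P = record { tree = P ; L = L T ; L-leaf = L-leaf T }

  L-of-leaf : ∀ {v} → v ≢ u → deg v ≡ 1 → L T v ≡ true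
  L-of-leaf {v} v≢u deg≡1 with L T v in Lv
  ... | true = refl
  ... | false = ⊥-elim (v≢u (only-L̄-leaf v Lv deg≡1))

  L-parentDart : ∀ {v} → v ≢ u → deg v ≡ 1 → L T (proj₁ (parentDart v)) ≡ true
  L-parentDart v≢u deg≡1 = subst (λ w → L T w ≡ true) (sym (parentDart-source v≢u)) (L-of-leaf v≢u deg≡1)

  glue-cut : ∀ {P₀ P₁ : PlaneTree n deg} {a b : Fin n} (e : Dart n deg) →
             a ≢ u → deg a ≡ 1 → b ≢ u → deg b ≡ 1 → a ≢ b →
             PlaneTree.α P₀ (parentDart a) ≢ parentDart b → parentDart a ≢ e → parentDart b ≢ e →
             (∀ d → PlaneTree.α P₁ d ≡ glueCut (PlaneTree.α P₀) (parentDart a) (parentDart b) e d) →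
             GlueCut (withTree P₀) (withTree P₁)
  glue-cut {a = a} {b} e a≢u deg-a b≢u deg-b a≢b αla≢lb la≢e lb≢e is-glueCut =
    parentDart a , parentDart b , e , L-parentDart a≢u deg-a , L-parentDart b≢u deg-b ,
    (λ eq → a≢b (trans (sym (parentDart-source a≢u)) (trans eq (parentDart-source b≢u)))) ,
    αla≢lb , ≢-sym la≢e , ≢-sym lb≢e , is-glueCut , λ _ → refl

  p : Fin n
  p = proj₁ (β (u , root-dart))

  p≢u : p ≢ u
  p≢u p≡u = β-nofix (u , root-dart) (deg1-dart-unique deg-u _ _ p≡u refl)

  opaque
    D : ℕ
    D = deg (proj₁ (argmax-Fin deg))

    deg≤D : ∀ w → deg w ≤ D
    deg≤D = proj₂ (argmax-Fin deg)

    D-attained : ∃ λ w → deg w ≡ D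
    D-attained = proj₁ (argmax-Fin deg) , refl

  module NeighbourNotMaximal (deg-p<D : deg p < D) where

    -- Maximising depth-if-max picks a deepest vertex m of maximal degree.
    depth-if-max : Fin n → ℕ
    depth-if-max v = if deg v ≡ᵇ D then suc (depth v) else 0

    depth-of-max : ∀ {w} → deg w ≡ D → depth-if-max w ≡ suc (depth w)
    depth-of-max {w} deg≡D = cong (λ b → if b then suc (depth w) else 0) (dec-true (deg w ≟ D) deg≡D)

    depth-of-other : ∀ {w} → deg w ≢ D → depth-if-max w ≡ 0
    depth-of-other {w} deg≢D = cong (λ b → if b then suc (depth w) else 0) (dec-false (deg w ≟ D) deg≢D)

    opaque
      m : Fin n
      m = proj₁ (argmax-Fin depth-if-max)

      depth-if-max≤m : ∀ w → depth-if-max w ≤ depth-if-max m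
      depth-if-max≤m = proj₂ (argmax-Fin depth-if-max)

    deg-m : deg m ≡ D
    deg-m with deg m ≟ D
    ... | yes deg≡D = deg≡D
    ... | no deg≢D = let (w , deg-w) = D-attained in
      ⊥-elim (1+n≢0 (n≤0⇒n≡0 (subst₂ _≤_ (depth-of-max deg-w) (depth-of-other deg≢D) (depth-if-max≤m w))))

    deepest : ∀ {w} → deg w ≡ D → depth w ≤ depth m
    deepest deg≡D = s≤s⁻¹ (subst₂ _≤_ (depth-of-max deg≡D) (depth-of-max deg-m) (depth-if-max≤m _))

    deg≤deg-m : ∀ w → deg w ≤ deg m
    deg≤deg-m w = subst (deg w ≤_) (sym deg-m) (deg≤D w)

    m≢u : m ≢ u
    m≢u m≡u = <-irrefl refl (≤-<-trans (deg≥1 p≢u) (subst (deg p <_) (trans (sym deg-m) (trans (cong deg m≡u) deg-u)) deg-p<D))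

    m≢p : m ≢ p
    m≢p m≡p = <-irrefl (trans (cong deg (sym m≡p)) deg-m) deg-p<D

    p≽m : p ≽ m
    p≽m = let (c , c≢u , pc≡u , c≽m) = child-towards (root-≽ m) m≢u in subst (_≽ m) (c≡p c≢u pc≡u) c≽m
      where
      c≡p : ∀ {c} → c ≢ u → parent c ≡ u → c ≡ p
      c≡p {c} c≢u pc≡u = trans (sym (parentDart-source c≢u))
        (cong proj₁ (β-transpose (deg1-dart-unique deg-u _ (u , root-dart) pc≡u refl)))

    3≤deg-m : 3 ≤ deg m
    3≤deg-m = subst (3 ≤_) (sym deg-m) (≤-trans (s≤s 2≤deg-p) deg-p<D)
      where
      2≤deg-p : 2 ≤ deg p
      2≤deg-p = let (c , c≢u , pc≡p , _) = child-towards p≽m m≢p in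
        distinct-darts⇒2≤deg (parentDart p) (β (parentDart c)) (parentDart-source p≢u) pc≡p (parentDart≢opposite p≢u c≢u)

    3≰1 : ¬ 3 ≤ 1
    3≰1 (s≤s ())

    leaf≢m : ∀ {a} → deg a ≡ 1 → a ≢ m
    leaf≢m deg≡1 a≡m = 3≰1 (subst (3 ≤_) (trans (cong deg (sym a≡m)) deg≡1) 3≤deg-m)

    children-of-m : ChildrenAfterParent m
    children-of-m = children-after-parent m≢u 3≤deg-m

    open ChildrenAfterParent children-of-m
      renaming (child₁ to q₁; child₂ to q₂; child₁≢r to q₁≢u; child₂≢r to q₂≢u; child₁-at to q₁-at; child₂-at to q₂-at)

    pq₁≡m : parent q₁ ≡ m
    pq₁≡m = parent-child₁ m≢u 3≤deg-m children-of-m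

    pq₂≡m : parent q₂ ≡ m
    pq₂≡m = parent-child₂ m≢u 3≤deg-m children-of-m

    q₁≢q₂ : q₁ ≢ q₂
    q₁≢q₂ = child₁≢child₂ m≢u 3≤deg-m children-of-m

    record ThirdLeaf : Set where
      field
        a : Fin n
        a≢u : a ≢ u
        deg-a : deg a ≡ 1
        q₁⋡a : ¬ q₁ ≽ a
        q₂⋡a : ¬ q₂ ≽ a

    third-leaf-if-deg≥4 : 4 ≤ deg m → ThirdLeaf
    third-leaf-if-deg≥4 4≤deg-m with parentDart-at m m≢u
    ... | P , pd≡P with ∃-avoiding-three P (cyc P) (cyc (cyc P)) 4≤deg-m
    ...   | k , k≢P , k≢c₁ , k≢c₂ with child-at (m , k) refl (λ eq → k≢P (position-injective (trans eq pd≡P)))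
    ...     | q , q≢u , q-at =
      record { a = leaf ; a≢u = ≽-non-root q≢u ≽leaf ; deg-a = deg-leaf
             ; q₁⋡a = beside (trans q₁-at (cong σ pd≡P)) q₁≢u k≢c₁
             ; q₂⋡a = beside (trans q₂-at (cong (σ ∘ σ) pd≡P)) q₂≢u k≢c₂ }
      where
      open LeafBelow (leaf-below q q≢u)

      beside : ∀ {q′ j} → β (parentDart q′) ≡ (m , j) → q′ ≢ u → k ≢ j → ¬ q′ ≽ leaf
      beside {q′} q′-at q′≢u k≢j q′≽leaf =
        k≢j (position-injective (trans (sym q-at) (trans (cong (λ c → β (parentDart c)) q≡q′) q′-at)))
        where
        q≡q′ : q ≡ q′
        q≡q′ = siblings-disjoint q≢u q′≢u (trans (cong proj₁ q-at) (sym (cong proj₁ q′-at))) ≽leaf q′≽leaf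

    -- Any other vertex m₂ of maximal degree is not below m, as m is deepest; so one of the two
    -- children of m₂ is not an ancestor of m, and every leaf below that child is away from m.
    module BesideSecondVertex {m₂ : Fin n} (m₂≢m : m₂ ≢ m) (deg-m₂ : deg m₂ ≡ deg m) where

      3≤deg-m₂ : 3 ≤ deg m₂
      3≤deg-m₂ = subst (3 ≤_) (sym deg-m₂) 3≤deg-m

      m₂≢u : m₂ ≢ u
      m₂≢u m₂≡u = 3≰1 (subst (3 ≤_) (trans (cong deg m₂≡u) deg-u) 3≤deg-m₂)

      m⋡m₂ : ¬ m ≽ m₂
      m⋡m₂ m≽m₂ = <-irrefl refl (<-≤-trans (≽⇒depth< m≽m₂ m₂≢m) (deepest (trans deg-m₂ deg-m)))

      children : ChildrenAfterParent m₂
      children = children-after-parent m₂≢u 3≤deg-m₂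

      open ChildrenAfterParent children

      leaf-beside : ∀ {c} → c ≢ u → parent c ≡ m₂ → ¬ c ≽ m → ThirdLeaf
      leaf-beside {c} c≢u pc≡m₂ c⋡m =
        record { a = leaf ; a≢u = ≽-non-root c≢u ≽leaf ; deg-a = deg-leaf
               ; q₁⋡a = m⋡leaf ∘ ≽-trans (parent⇒≽ q₁≢u pq₁≡m) ; q₂⋡a = m⋡leaf ∘ ≽-trans (parent⇒≽ q₂≢u pq₂≡m) }
        where
        open LeafBelow (leaf-below c c≢u)

        c≢m : c ≢ m
        c≢m c≡m = c⋡m (subst (c ≽_) c≡m here)

        m⋡leaf : ¬ m ≽ leaf
        m⋡leaf m≽leaf = [ c⋡m , (λ m≽c → m⋡m₂ (subst (m ≽_) pc≡m₂ (proj₂ (≽-parent m≽c c≢m)))) ]′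
                          (≽-linear ≽leaf m≽leaf)

      third-leaf : ThirdLeaf
      third-leaf = by-cases (child₁ ≽? m)
        where
        by-cases : Dec (child₁ ≽ m) → ThirdLeaf
        by-cases (no child₁⋡m) = leaf-beside child₁≢r (parent-child₁ m₂≢u 3≤deg-m₂ children) child₁⋡m
        by-cases (yes child₁≽m) = leaf-beside child₂≢r (parent-child₂ m₂≢u 3≤deg-m₂ children)
          (λ child₂≽m → child₁≢child₂ m₂≢u 3≤deg-m₂ children
            (siblings-disjoint child₁≢r child₂≢r
              (trans (parent-child₁ m₂≢u 3≤deg-m₂ children) (sym (parent-child₂ m₂≢u 3≤deg-m₂ children)))
              child₁≽m child₂≽m))

    -- When every degree is at most 3, the weight condition forces a second L̄-vertex of degree 3.
    module _ (deg≡3 : deg m ≡ 3) where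

      all-deg≥1 : ∀ v → 1 ≤ deg v
      all-deg≥1 v with v ≟F u
      ... | yes v≡u = ≤-reflexive (sym (trans (cong deg v≡u) deg-u))
      ... | no v≢u = deg≥1 v≢u

      L̄m : L T m ≡ false
      L̄m with L T m in Lm
      ... | false = refl
      ... | true = ⊥-elim (3≰1 (subst (3 ≤_) (L-leaf T m Lm) 3≤deg-m))

      μ₀ : mu T 0 ≡ 0
      μ₀ = count-none (L̄-of-degree T 0) (allFin n)
             (λ {v} _ → L̄-of-degree-reject T (λ deg≡0 → <⇒≢ (all-deg≥1 v) (sym deg≡0)))

      μ≥4 : ∀ i → 4 ≤ i → mu T i ≡ 0
      μ≥4 i 4≤i = count-none (L̄-of-degree T i) (allFin n) (λ {v} _ → L̄-of-degree-reject T (deg≢i v))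
        where
        deg≢i : ∀ v → deg v ≢ i
        deg≢i v deg≡i = <-irrefl refl (≤-trans 4≤i (subst (_≤ 3) deg≡i (subst (deg v ≤_) deg≡3 (deg≤deg-m v))))

      3≤sumDeg : 3 ≤ sumDeg deg
      3≤sumDeg = subst (_≤ sumDeg deg) deg≡3 (∈⇒≤sum (∈-map⁺ deg (∈-allFin m)))

      2≤μ₃ : 2 ≤ mu T 3
      2≤μ₃ = 1≤≢1⇒2≤ (1≤count (L̄-of-degree T 3) (∈-allFin m) (L̄-of-degree-intro T L̄m deg≡3))
                     (μ₃≢1 μ₀ μ≥4 3≤sumDeg)

      third-leaf-if-deg≡3 : ThirdLeaf
      third-leaf-if-deg≡3 with 2≤count⇒∃-≢ (L̄-of-degree T 3) m 2≤μ₃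
      ... | m₂ , m₂≢m , L̄₃-m₂ =
        BesideSecondVertex.third-leaf m₂≢m (trans (proj₂ (L̄-of-degree-elim T L̄₃-m₂)) (sym deg≡3))

    third-leaf : ThirdLeaf
    third-leaf with deg m ≟ 3
    ... | yes deg≡3 = third-leaf-if-deg≡3 deg≡3
    ... | no deg≢3 = third-leaf-if-deg≥4 (≤∧≢⇒< 3≤deg-m (≢-sym deg≢3))

    open ThirdLeaf third-leaf

    q₁≢a : q₁ ≢ a
    q₁≢a q₁≡a = q₁⋡a (subst (q₁ ≽_) q₁≡a here)

    q₂≢a : q₂ ≢ a
    q₂≢a q₂≡a = q₂⋡a (subst (q₂ ≽_) q₂≡a here)

    L-pd-a : L T (proj₁ (parentDart a)) ≡ true
    L-pd-a = L-parentDart a≢u deg-a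

    nice-after-exchange : ∀ {g} (P′ : PlaneTree n deg) → Steps 0 g T (withTree P′) → g ≤ 2 → (x y : Dart n deg) →
             L T (proj₁ x) ≡ true → L T (proj₁ y) ≡ true →
             PlaneTree.α P′ x ≡ σ (parentDart m) → PlaneTree.α P′ y ≡ σ (σ (parentDart m)) → ReachesNice T
    nice-after-exchange {g} P′ steps g≤2 x y Lx Ly αx αy =
      1 , g , E.exchanged , ≤-refl , g≤2 , steps-then-exchange steps E.exchange ,
      E.nice-exchanged μ₁≡1 maximal , E.mu-exchanged , E.ell-exchanged
      where
      x≢y : proj₁ x ≢ proj₁ y
      x≢y x≡y = σ-≢ (σ (parentDart m)) 2≤deg
        (sym (trans (sym αx) (trans (cong (PlaneTree.α P′) (deg1-dart-unique (L-leaf T _ Lx) x y refl (sym x≡y))) αy)))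
        where
        2≤deg : 2 ≤ deg (proj₁ (parentDart m))
        2≤deg = subst (λ v → 2 ≤ deg v) (sym (parentDart-source m≢u)) (≤-trans (n≤1+n 2) 3≤deg-m)

      maximal : ∀ w → deg w ≤ deg (proj₁ (PlaneTree.α P′ x))
      maximal w = subst (λ v → deg w ≤ deg v) (sym (trans (cong proj₁ αx) (parentDart-source m≢u))) (deg≤deg-m w)

      module E = Exchange (withTree P′) deg-u L̄u Lx Ly x≢y (trans (cong σ αx) (sym αy))

    opaque
      replace-inner-child : ∀ {q q′} → q ≢ u → parent q ≡ m → deg q ≢ 1 → ¬ q ≽ a →
                            q′ ≢ u → parent q′ ≡ m → q′ ≢ q → q′ ≢ a →
                            Σ (PlaneTree n deg) λ P′ → GlueCut T (withTree P′) ×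
                              PlaneTree.α P′ (parentDart a) ≡ β (parentDart q) ×
                              PlaneTree.α P′ (parentDart q′) ≡ β (parentDart q′)
      replace-inner-child {q} {q′} q≢u pq≡m deg≢1 q⋡a q′≢u pq′≡m q′≢q q′≢a =
        M.tree′ , glue-cut {P₀ = tree T} {P₁ = M.tree′} M.e a≢u deg-a b≢u deg-leaf M.a≢b M.βla≢lb M.la≢e M.lb≢e M.g-def ,
        M.g-la , M.keeps-parent-edge q′≢u q′≢a q′≢b q′≢q
        where
        open LeafBelow (leaf-below q q≢u) renaming (leaf to b; ≽leaf to q≽b)

        b≢u : b ≢ u
        b≢u = ≽-non-root q≢u q≽b

        b≢q : b ≢ q
        b≢q b≡q = deg≢1 (trans (cong deg (sym b≡q)) deg-leaf)

        q′≢b : q′ ≢ b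
        q′≢b q′≡b = q′≢q (siblings-disjoint q′≢u q≢u (trans pq′≡m (sym pq≡m)) (subst (q′ ≽_) q′≡b here) q≽b)

        module M = OneGlueCut q≢u pq≡m a≢u b≢u deg-a deg-leaf (leaf≢m deg-a) q≽b b≢q q⋡a

    both-children-inner : deg q₁ ≢ 1 → deg q₂ ≢ 1 → ReachesNice T
    both-children-inner deg₁≢1 deg₂≢1 =
      nice-after-exchange N.tree″ (gc {T₁ = withTree N.First.tree′} cut₁ (gc {T₁ = withTree N.tree″} cut₂ done)) ≤-refl
             (parentDart a) (parentDart b) L-pd-a (L-parentDart b≢u deg-b) (trans N.g-pd-a q₁-at) (trans N.g-pd-b q₂-at)
      where
      open LeafBelow (leaf-below q₁ q₁≢u) using () renaming (leaf to b; ≽leaf to q₁≽b; deg-leaf to deg-b)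
      open LeafBelow (leaf-below q₂ q₂≢u) using () renaming (leaf to b′; ≽leaf to q₂≽b′; deg-leaf to deg-b′)

      b≢u : b ≢ u
      b≢u = ≽-non-root q₁≢u q₁≽b

      b′≢u : b′ ≢ u
      b′≢u = ≽-non-root q₂≢u q₂≽b′

      module N = TwoGlueCuts q₁≢u pq₁≡m q₂≢u pq₂≡m q₁≢q₂ a≢u b≢u b′≢u deg-a deg-b deg-b′ (leaf≢m deg-a)
        q₁≽b (λ b≡q₁ → deg₁≢1 (trans (cong deg (sym b≡q₁)) deg-b)) q₁⋡a
        q₂≽b′ (λ b′≡q₂ → deg₂≢1 (trans (cong deg (sym b′≡q₂)) deg-b′)) q₂⋡a

      cut₁ : GlueCut T (withTree N.First.tree′)
      cut₁ = glue-cut {P₀ = tree T} {P₁ = N.First.tree′} N.First.e a≢u deg-a b≢u deg-b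
                      N.First.a≢b N.First.βla≢lb N.First.la≢e N.First.lb≢e N.First.g-def

      cut₂ : GlueCut (withTree N.First.tree′) (withTree N.tree″)
      cut₂ = glue-cut {P₀ = N.First.tree′} {P₁ = N.tree″} (β (parentDart q₂)) b≢u deg-b b′≢u deg-b′
                      N.b≢b′ N.g₁la≢lb N.la≢e N.lb≢e N.Second.g-def

    reaches-nice : ReachesNice T
    reaches-nice = by-leafness (deg q₁ ≟ 1) (deg q₂ ≟ 1)
      where
      by-leafness : Dec (deg q₁ ≡ 1) → Dec (deg q₂ ≡ 1) → ReachesNice T
      by-leafness (yes deg₁≡1) (yes deg₂≡1) =
        nice-after-exchange (tree T) done z≤n (parentDart q₁) (parentDart q₂)
               (L-parentDart q₁≢u deg₁≡1) (L-parentDart q₂≢u deg₂≡1) q₁-at q₂-at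
      by-leafness (yes deg₁≡1) (no deg₂≢1) =
        let (P′ , cut , a-at-q₂ , q₁-kept) = replace-inner-child q₂≢u pq₂≡m deg₂≢1 q₂⋡a q₁≢u pq₁≡m q₁≢q₂ q₁≢a in
        nice-after-exchange P′ (gc {T₁ = withTree P′} cut done) (s≤s z≤n) (parentDart q₁) (parentDart a)
               (L-parentDart q₁≢u deg₁≡1) L-pd-a (trans q₁-kept q₁-at) (trans a-at-q₂ q₂-at)
      by-leafness (no deg₁≢1) (yes deg₂≡1) =
        let (P′ , cut , a-at-q₁ , q₂-kept) = replace-inner-child q₁≢u pq₁≡m deg₁≢1 q₁⋡a q₂≢u pq₂≡m (≢-sym q₁≢q₂) q₂≢a in
        nice-after-exchange P′ (gc {T₁ = withTree P′} cut done) (s≤s z≤n) (parentDart a) (parentDart q₂)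
               L-pd-a (L-parentDart q₂≢u deg₂≡1) (trans a-at-q₁ q₁-at) (trans q₂-kept q₂-at)
      by-leafness (no deg₁≢1) (no deg₂≢1) = both-children-inner deg₁≢1 deg₂≢1

  reaches-nice : ReachesNice T
  reaches-nice = by-degree (D ≤? deg p)
    where
    by-degree : Dec (D ≤ deg p) → ReachesNice T
    by-degree (yes D≤deg-p) = already-nice (inj₂ (μ₁≡1 , (u , root-dart) , deg-u , L̄u , λ w → ≤-trans (deg≤D w) D≤deg-p))
    by-degree (no D≰deg-p) = NeighbourNotMaximal.reaches-nice (≰⇒> D≰deg-p)

unique-L̄-leaf : ∀ {n deg} (T : DecTree n deg) → mu T 1 ≡ 1 →
                ∃ λ u → L T u ≡ false × deg u ≡ 1 × (∀ v → L T v ≡ false → deg v ≡ 1 → v ≡ u)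
unique-L̄-leaf {n} {deg} T μ₁≡1 with 1≤count⇒∃ (L̄-of-degree T 1) (allFin n) (≤-reflexive (sym μ₁≡1))
... | u , L̄₁u = u , proj₁ (L̄-of-degree-elim T L̄₁u) , proj₂ (L̄-of-degree-elim T L̄₁u) , only
  where
  only : ∀ v → L T v ≡ false → deg v ≡ 1 → v ≡ u
  only v L̄v deg-v with v ≟F u
  ... | yes v≡u = v≡u
  ... | no v≢u = ⊥-elim (<-irrefl refl (subst (2 ≤_) μ₁≡1
          (2≤count (L̄-of-degree T 1) (∈-allFin v) (∈-allFin u) v≢u (L̄-of-degree-intro T L̄v deg-v) L̄₁u)))

lemma4p4 : ∀ {n} {deg : Fin n → ℕ} (T : DecTree n deg) (k : ℕ) →
    ell T + 2 ≡ k →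
    weightSum T ≡ + k - + 4 →
    mu T 1 ≤ 1 →
    ¬ (k ≡ 4 × mu T 0 ≡ 0 × mu T 1 ≡ 1 × mu T 3 ≡ 1 × (∀ i → 4 ≤ i → mu T i ≡ 0)) →
    Σ ℕ λ d → Σ ℕ λ g → Σ (DecTree n deg) λ T' →
      d ≤ 1 × g ≤ 2 × Steps d g T T' × Nice T' ×
      (∀ i → mu T' i ≡ mu T i) × ell T' ≡ ell T
lemma4p4 {zero} T k _ _ _ _ = already-nice (inj₁ refl)
lemma4p4 {suc n′} T k _ weight μ₁≤1 ¬exceptional with n≤1⇒n≡0∨n≡1 μ₁≤1
... | inj₁ μ₁≡0 = already-nice (inj₁ μ₁≡0)
... | inj₂ μ₁≡1 =
  let (u , L̄u , deg-u , only) = unique-L̄-leaf T μ₁≡1 in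
  SingleL̄Leaf.reaches-nice T L̄u deg-u only μ₁≡1 (μ₃≢1 T k weight ¬exceptional μ₁≡1)
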